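{- Let $k\ge 3$ and let $f(x_1,\dots,x_k)=\mathrm{sign}\left((k-2)x_1+\sum_{i=2}^k x_i\right)$ be the monarchy predicate, with Fourier expansion $f(x)=\sum_{S\subseteq[1,k]}\hat f_S\prod_{i\in S}x_i$. Let $$C=\frac{\hat f_{P}-(k-2)\hat f_{C}}{\hat f_{3C}\binom{k-1}{3}-\hat f_{P+2C}\binom{k-1}{2}}.$$ Let $D$ be any probability distribution supported on $\{x\in\{ -1,+1\}^k: f(x)=1\}$, let $b_i=\mathbb{E}_D[x_i]$, and let $\epsilon>0$. Consider a rounding under which the expected values of the monomials $x_S=\prod_{i\in S}x_i$ are: $\mathbb{E}[x_i]=\epsilon b_i$ for each $i$; $\mathbb{E}[x_{i_1}x_{i_2}x_{i_3}]=C\epsilon\,\mathrm{sign}(b_{i_1}b_{i_2}b_{i_3})\min\{|b_{i_1}|,|b_{i_2}|,|b_{i_3}|\}$ for distinct $i_1,i_2,i_3$; and $\mathbb{E}[x_S]=0$ for all other nonempty $S$. Then $\sum_{S\neq\emptyset}\hat f_S\,\mathbb{E}[x_S]>0$, i.e. the expected value of $f$ after rounding exceeds that of a uniformly random assignment (the rounded assignment satisfies $f$ with probability greater than $\frac12$).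
   Context: $x_1$ is called the president and $x_2,\dots,x_k$ the citizens. By symmetry, $\hat f_S$ depends only on whether $1\in S$ and on $|S\setminus\{1\}|$: $\hat f_{aC}$ denotes the Fourier coefficient $\hat f_S$ of any set $S\subseteq\{2,\dots,k\}$ of $a$ citizens, and $\hat f_{P+aC}$ denotes $\hat f_S$ for $S=\{1\}\cup T$ with $T\subseteq\{2,\dots,k\}$, $|T|=a$; in particular $\hat f_P=\hat f_{\{1\}}$ and $\hat f_C=\hat f_{\{2\}}$. Here $\hat f_S=\mathbb{E}_{x\in\{ -1,+1\}^k}[f(x)\prod_{i\in S}x_i]$, and $\mathrm{sign}(0)=0$.
   Formalization: The probability distribution D is given by rational point masses, and the parameter ε ranges over the positive rationals. -}

module Defs where

open import Data.Bool using (Bool; true; false; if_then_else_; not)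
open import Data.Nat as ℕ using (ℕ; zero; suc)
open import Data.Nat.Combinatorics using (_C_)
open import Data.Fin using (Fin; toℕ)
open import Data.List using (List; []; _∷_; map; _++_; filterᵇ; allFin; foldr; null)
open import Data.Integer using (+_)
open import Data.Rational using (ℚ; 0ℚ; 1ℚ; ½; _+_; _*_; _-_; -_; _≤ᵇ_; _⊓_; ∣_∣; _÷_; ≢-nonZero)
open import Data.Rational.Properties using (_≟_)
open import Relation.Nullary using (yes; no)
open import Relation.Binary.PropositionalEquality using (_≡_)

ℕtoℚ : ℕ → ℚ
ℕtoℚ n = Data.Rational._/_ (+ n) 1

-- sign, with sign 0 = 0
signℚ : ℚ → ℚ
signℚ q = if q ≤ᵇ 0ℚ then (if 0ℚ ≤ᵇ q then 0ℚ else (- 1ℚ)) else 1ℚ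

-- total division; only used where the denominator is (meant to be) nonzero
_÷′_ : ℚ → ℚ → ℚ
p ÷′ q with q ≟ 0ℚ
... | yes _ = 0ℚ
... | no q≢0 = _÷_ p q {{≢-nonZero q≢0}}

sumℚ : List ℚ → ℚ
sumℚ = foldr _+_ 0ℚ

sumFin : (n : ℕ) → (Fin n → ℚ) → ℚ
sumFin n g = sumℚ (map g (allFin n))

-- all Boolean vectors of length n (= the cube {-1,+1}^n, true ↦ +1,
-- and also = all subsets of [n], true ↦ member)
cube : (n : ℕ) → List (Fin n → Bool)
cube zero = (λ ()) ∷ []
cube (suc n) =
  map (λ v → λ { Fin.zero → true ; (Fin.suc i) → v i }) (cube n) ++
  map (λ v → λ { Fin.zero → false ; (Fin.suc i) → v i }) (cube n)

pm : Bool → ℚ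
pm true = 1ℚ
pm false = (- 1ℚ)

point : {k : ℕ} → (Fin k → Bool) → Fin k → ℚ
point x i = pm (x i)

-- the monarchy predicate: sign((k-2) x_1 + Σ_{i≥2} x_i), index 0 is the president
weight : (k : ℕ) → Fin k → ℚ
weight k i with toℕ i
... | zero = ℕtoℚ (k ℕ.∸ 2)
... | suc _ = 1ℚ

monarchy : (k : ℕ) → (Fin k → ℚ) → ℚ
monarchy k x = signℚ (sumFin k (λ i → weight k i * x i))

monomial : {k : ℕ} → (Fin k → Bool) → (Fin k → ℚ) → ℚ
monomial {k} S x = foldr (λ i acc → (if S i then x i else 1ℚ) * acc) 1ℚ (allFin k)

half^ : ℕ → ℚ
half^ zero = 1ℚ
half^ (suc n) = ½ * half^ n

fourier : (k : ℕ) → ((Fin k → ℚ) → ℚ) → (Fin k → Bool) → ℚ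
fourier k f S = half^ k * sumℚ (map (λ x → f (point x) * monomial S (point x)) (cube k))

-- subsets used for the symmetric coefficients (index 0 = president, 1..k-1 citizens)
-- citizensUpTo a = {citizens 1..a};  withPresident adds the president
citizensUpTo : {k : ℕ} → ℕ → Fin k → Bool
citizensUpTo a i with toℕ i
... | zero = false
... | suc j = j ℕ.<ᵇ a

withPresident : {k : ℕ} → (Fin k → Bool) → Fin k → Bool
withPresident S i with toℕ i
... | zero = true
... | suc _ = S i

fhatC : (k : ℕ) → ℕ → ℚ
fhatC k a = fourier k (monarchy k) (citizensUpTo a)

fhatPC : (k : ℕ) → ℕ → ℚ
fhatPC k a = fourier k (monarchy k) (withPresident (citizensUpTo a))

constC : (k : ℕ) → ℚ
constC k =
  (fhatPC k 0 - ℕtoℚ (k ℕ.∸ 2) * fhatC k 1)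
  ÷′ (fhatC k 3 * ℕtoℚ ((k ℕ.∸ 1) C 3) - fhatPC k 2 * ℕtoℚ ((k ℕ.∸ 1) C 2))

record IsDistributionOn (k : ℕ) (p : (Fin k → Bool) → ℚ) : Set where
  field
    nonneg  : ∀ x → 0ℚ Data.Rational.≤ p x
    sumOne  : sumℚ (map p (cube k)) ≡ 1ℚ

bias : (k : ℕ) → ((Fin k → Bool) → ℚ) → Fin k → ℚ
bias k p i = sumℚ (map (λ x → p x * point x i) (cube k))

members : {k : ℕ} → (Fin k → Bool) → List (Fin k)
members {k} S = filterᵇ S (allFin k)

roundedMoment : (k : ℕ) → (Fin k → ℚ) → ℚ → (Fin k → Bool) → ℚ
roundedMoment k b ε S with members S
... | i ∷ [] = ε * b i
... | i ∷ j ∷ l ∷ [] =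
        constC k * ε * signℚ (b i * b j * b l) * (∣ b i ∣ ⊓ ∣ b j ∣ ⊓ ∣ b l ∣)
... | _ = 0ℚ

nonempty : {k : ℕ} → (Fin k → Bool) → Bool
nonempty S = not (null (members S))

roundedAdvantage : (k : ℕ) → ((Fin k → Bool) → ℚ) → ℚ → ℚ
roundedAdvantage k p ε =
  sumℚ (map (λ S → fourier k (monarchy k) S * roundedMoment k (bias k p) ε S)
            (filterᵇ nonempty (cube k)))

-- With n = k - 1 citizens, f(x) = 1 - 2·[every citizen votes -1] when the president votes +1,
-- and f(x) = 2·[every citizen votes +1] - 1 otherwise. Averaging against characters, f̂ only
-- involves the two unanimous points: with δ = 2^(1-n), f̂_P = 1 - δ, f̂_aC = δ for odd a,
-- f̂_(P+aC) = -δ for even a ≥ 2, and every other coefficient vanishes; also C ≥ 0 since n δ ≤ 1.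
-- If f(x) = 1 then x_1 + x_i ≥ 0 for every citizen i, so b_i ≥ -b_1; this forces
-- sign(b_1 b_i b_j)·min ≤ b_1 and sign(b_i b_j b_l)·min ≥ -b_1, hence each of the C(k,3) triple
-- terms is at least -δ C ε b_1. By the choice of C these bounds add up to -(f̂_P - (k-2) δ) ε b_1,
-- so together with the singleton terms f̂_P ε b_1 and δ ε b_i what remains is
-- ε δ ((k-2) b_1 + Σ_{i≥2} b_i) = ε δ E_D[(k-2) x_1 + Σ_{i≥2} x_i], positive as D is supported on f = 1.

module Submission where

open import Defs
open import Data.Nat using (ℕ; _≤_)
open import Data.Fin using (Fin)
open import Data.Bool using (Bool)
open import Data.Rational using (ℚ; 0ℚ; 1ℚ; _<_)
open import Relation.Binary.PropositionalEquality using (_≡_)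

open import Data.Bool using (true; false; if_then_else_; not)
open import Data.Bool.Properties using (T-≡; ¬-not)
open import Data.Empty using (⊥-elim)
open import Data.Fin using (zero; suc; toℕ)
import Data.Integer as ℤ
import Data.Integer.Tactic.RingSolver as ℤ
open import Data.List using (List; []; _∷_; map; _++_; filterᵇ; allFin; length; foldr; null)
import Data.List.Properties as List
open import Data.Nat as ℕ using (zero; suc)
open import Data.Nat.Combinatorics using (_C_; nCk+nC[k+1]≡[n+1]C[k+1])
import Data.Nat.Coprimality as Coprimality
import Data.Nat.Properties as ℕ
open import Data.Product using (_×_; _,_; proj₁; proj₂)
open import Data.Rational
  using (_+_; _*_; _-_; -_; ½; _≤ᵇ_; _⊓_; ∣_∣; mkℚ; toℚᵘ; ≢-nonZero; nonNegative; positive; negative)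
  renaming (_≤_ to _≤ℚ_)
import Data.Rational.Properties as ℚ
import Data.Rational.Unnormalised as ℚᵘ
import Data.Rational.Unnormalised.Properties as ℚᵘ
open import Data.Sum using (_⊎_; inj₁; inj₂)
open import Data.Unit using (tt)
open import Data.Vec.Functional using (head; tail)
open import Function using (_∘_; Equivalence)
open import Level using (0ℓ)
open import Relation.Binary.Definitions using (tri<; tri≈; tri>)
open import Relation.Binary.PropositionalEquality
  using (_≢_; refl; sym; trans; cong; cong₂; subst; subst₂; module ≡-Reasoning)
open import Relation.Nullary.Decidable using (dec⇒maybe; yes; no; T?)
open import Relation.Nullary.Negation using (¬_)
open import Tactic.RingSolver using (solve-∀)
open import Tactic.RingSolver.Core.AlmostCommutativeRing using (AlmostCommutativeRing; fromCommutativeRing)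

open import Algebra.Bundles using (CommutativeMonoid)
open import Algebra.Properties.CommutativeSemigroup
  (CommutativeMonoid.commutativeSemigroup ℚ.+-0-commutativeMonoid)
  using () renaming (interchange to +-interchange)
open import Algebra.Properties.CommutativeSemigroup
  (CommutativeMonoid.commutativeSemigroup ℚ.*-1-commutativeMonoid)
  using (x∙yz≈y∙xz) renaming (interchange to *-interchange)
open import Algebra.Properties.Group ℚ.+-0-group using () renaming (⁻¹-involutive to neg-involutive)

private variable
  A B : Set

ℚ-ring : AlmostCommutativeRing 0ℓ 0ℓ
ℚ-ring = fromCommutativeRing ℚ.+-*-commutativeRing (λ q → dec⇒maybe (0ℚ ℚ.≟ q))

-- ℕtoℚ normalises, so its successor law is checked on unnormalised representatives.
ℕtoℚ-suc : ∀ n → ℕtoℚ (suc n) ≡ 1ℚ + ℕtoℚ n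
ℕtoℚ-suc n = ℚ.toℚᵘ-injective (begin
  toℚᵘ (ℕtoℚ (suc n))             ≈⟨ ℚᵘ.≃-reflexive (cong toℚᵘ (ℕtoℚ-mkℚ (suc n))) ⟩
  ℚᵘ.mkℚᵘ (ℤ.+ suc n) 0           ≈⟨ add-representatives ⟩
  toℚᵘ 1ℚ ℚᵘ.+ toℚᵘ (ℕtoℚ n)      ≈⟨ ℚᵘ.≃-sym (ℚ.toℚᵘ-homo-+ 1ℚ (ℕtoℚ n)) ⟩
  toℚᵘ (1ℚ + ℕtoℚ n)              ∎)
  where
  open ℚᵘ.≃-Reasoning
  ℕtoℚ-mkℚ : ∀ n → ℕtoℚ n ≡ mkℚ (ℤ.+ n) 0 (Coprimality.sym (Coprimality.1-coprimeTo n))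
  ℕtoℚ-mkℚ n = ℚ.normalize-coprime _
  cross-multiply : ∀ (a : ℤ.ℤ) →
                   (ℤ.+ 1 ℤ.+ a) ℤ.* (ℤ.+ 1 ℤ.* ℤ.+ 1) ≡ (ℤ.+ 1 ℤ.* ℤ.+ 1 ℤ.+ a ℤ.* ℤ.+ 1) ℤ.* ℤ.+ 1
  cross-multiply = ℤ.solve-∀
  add-representatives : ℚᵘ.mkℚᵘ (ℤ.+ suc n) 0 ℚᵘ.≃ toℚᵘ 1ℚ ℚᵘ.+ toℚᵘ (ℕtoℚ n)
  add-representatives rewrite ℕtoℚ-mkℚ n = ℚᵘ.*≡* (cross-multiply (ℤ.+ n))

ℕtoℚ-+ : ∀ m n → ℕtoℚ (m ℕ.+ n) ≡ ℕtoℚ m + ℕtoℚ n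
ℕtoℚ-+ zero    n = sym (ℚ.+-identityˡ (ℕtoℚ n))
ℕtoℚ-+ (suc m) n = begin
  ℕtoℚ (suc (m ℕ.+ n))     ≡⟨ ℕtoℚ-suc (m ℕ.+ n) ⟩
  1ℚ + ℕtoℚ (m ℕ.+ n)      ≡⟨ cong (1ℚ +_) (ℕtoℚ-+ m n) ⟩
  1ℚ + (ℕtoℚ m + ℕtoℚ n)   ≡⟨ ℚ.+-assoc 1ℚ (ℕtoℚ m) (ℕtoℚ n) ⟨
  1ℚ + ℕtoℚ m + ℕtoℚ n     ≡⟨ cong (_+ ℕtoℚ n) (ℕtoℚ-suc m) ⟨
  ℕtoℚ (suc m) + ℕtoℚ n    ∎
  where open ≡-Reasoning

ℕtoℚ-nonNeg : ∀ n → 0ℚ ≤ℚ ℕtoℚ n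
ℕtoℚ-nonNeg n = ℚ.nonNegative⁻¹ (ℕtoℚ n) {{ℚ.normalize-nonNeg n 1}}

ℕtoℚ-pos : ∀ {n} → 0 ℕ.< n → 0ℚ < ℕtoℚ n
ℕtoℚ-pos {suc n} _ = ℚ.positive⁻¹ (ℕtoℚ (suc n)) {{ℚ.normalize-pos (suc n) 1}}

odd-pos : ∀ c → 0ℚ < 1ℚ + (ℕtoℚ c + ℕtoℚ c)
odd-pos c = subst (0ℚ <_) (trans (ℕtoℚ-suc (c ℕ.+ c)) (cong (1ℚ +_) (ℕtoℚ-+ c c)))
                          (ℕtoℚ-pos {suc (c ℕ.+ c)} ℕ.z<s)

*-nonNeg : ∀ {p q} → 0ℚ ≤ℚ p → 0ℚ ≤ℚ q → 0ℚ ≤ℚ p * q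
*-nonNeg {p} {q} 0≤p 0≤q =
  ℚ.nonNegative⁻¹ (p * q) {{ℚ.nonNeg*nonNeg⇒nonNeg p {{nonNegative 0≤p}} q {{nonNegative 0≤q}}}}

*-pos : ∀ {p q} → 0ℚ < p → 0ℚ < q → 0ℚ < p * q
*-pos {p} {q} 0<p 0<q = ℚ.positive⁻¹ (p * q) {{ℚ.pos*pos⇒pos p {{positive 0<p}} q {{positive 0<q}}}}

scale-≤ : ∀ {r p q} → 0ℚ ≤ℚ r → p ≤ℚ q → r * p ≤ℚ r * q
scale-≤ {r} 0≤r = ℚ.*-monoˡ-≤-nonNeg r {{nonNegative 0≤r}}

p≤p+q : ∀ p {q} → 0ℚ ≤ℚ q → p ≤ℚ p + q
p≤p+q p 0≤q = ℚ.≤-trans (ℚ.≤-reflexive (sym (ℚ.+-identityʳ p))) (ℚ.+-monoʳ-≤ p 0≤q)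

0≤p+q⇒-q≤p : ∀ {p q} → 0ℚ ≤ℚ p + q → - q ≤ℚ p
0≤p+q⇒-q≤p {p} {q} 0≤p+q = subst₂ _≤ℚ_ (ℚ.+-identityʳ (- q)) (cancel p q) (ℚ.+-monoʳ-≤ (- q) 0≤p+q)
  where cancel : ∀ p q → - q + (p + q) ≡ p
        cancel = solve-∀ ℚ-ring

x*1+y*0≡x : ∀ x y → x * 1ℚ + y * 0ℚ ≡ x
x*1+y*0≡x = solve-∀ ℚ-ring

x*0+y*1≡y : ∀ x y → x * 0ℚ + y * 1ℚ ≡ y
x*0+y*1≡y = solve-∀ ℚ-ring

x+y*0≡x : ∀ x y → x + y * 0ℚ ≡ x
x+y*0≡x = solve-∀ ℚ-ring

x*0+y*0≤z*0 : ∀ x y z → x * 0ℚ + y * 0ℚ ≤ℚ z * 0ℚ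
x*0+y*0≤z*0 x y z = ℚ.≤-reflexive (both-zero x y z)
  where both-zero : ∀ x y z → x * 0ℚ + y * 0ℚ ≡ z * 0ℚ
        both-zero = solve-∀ ℚ-ring

÷′-cancelʳ : ∀ p {q} → 0ℚ < q → (p ÷′ q) * q ≡ p
÷′-cancelʳ p {q} 0<q with q ℚ.≟ 0ℚ
... | yes q≡0 = ⊥-elim (ℚ.<-irrefl (sym q≡0) 0<q)
... | no  q≢0 = trans (ℚ.*-assoc p _ q) (trans (cong (p *_) (ℚ.*-inverseˡ q {{≢-nonZero q≢0}})) (ℚ.*-identityʳ p))

÷′-nonNeg : ∀ {p q} → 0ℚ ≤ℚ p → 0ℚ < q → 0ℚ ≤ℚ p ÷′ q
÷′-nonNeg {p} {q} 0≤p 0<q with q ℚ.≟ 0ℚ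
... | yes q≡0 = ⊥-elim (ℚ.<-irrefl (sym q≡0) 0<q)
... | no  q≢0 = *-nonNeg 0≤p (ℚ.<⇒≤ (ℚ.positive⁻¹ _ {{ℚ.1/pos⇒pos q {{positive 0<q}}}}))

<⇒≱ : ∀ {p q} → p < q → ¬ q ≤ℚ p
<⇒≱ p<q q≤p = ℚ.<-irrefl refl (ℚ.<-≤-trans p<q q≤p)

≤ᵇ-true : ∀ {p q} → p ≤ℚ q → (p ≤ᵇ q) ≡ true
≤ᵇ-true = Equivalence.to T-≡ ∘ ℚ.≤⇒≤ᵇ

≤ᵇ-false : ∀ {p q} → ¬ p ≤ℚ q → (p ≤ᵇ q) ≡ false
≤ᵇ-false p≰q = ¬-not (p≰q ∘ ℚ.≤ᵇ⇒≤ ∘ Equivalence.from T-≡)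

signℚ-pos : ∀ {q} → 0ℚ < q → signℚ q ≡ 1ℚ
signℚ-pos {q} 0<q = cong (λ b → if b then (if 0ℚ ≤ᵇ q then 0ℚ else - 1ℚ) else 1ℚ) (≤ᵇ-false (<⇒≱ 0<q))

signℚ-neg : ∀ {q} → q < 0ℚ → signℚ q ≡ - 1ℚ
signℚ-neg q<0 = cong₂ (λ b c → if b then (if c then 0ℚ else - 1ℚ) else 1ℚ)
  (≤ᵇ-true (ℚ.<⇒≤ q<0)) (≤ᵇ-false (<⇒≱ q<0))

signℚ≡1⇒pos : ∀ {q} → signℚ q ≡ 1ℚ → 0ℚ < q
signℚ≡1⇒pos {q} sign≡1 with ℚ.<-cmp q 0ℚ
... | tri< q<0 _ _ with () ← trans (sym (signℚ-neg q<0)) sign≡1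
... | tri≈ _ refl _ with () ← sign≡1
... | tri> _ _ 0<q = 0<q

signℚ-bounds : ∀ q → - 1ℚ ≤ℚ signℚ q × signℚ q ≤ℚ 1ℚ
signℚ-bounds q with ℚ.<-cmp q 0ℚ
... | tri< q<0 _ _ rewrite signℚ-neg q<0 = ℚ.≤ᵇ⇒≤ tt , ℚ.≤ᵇ⇒≤ tt
... | tri≈ _ refl _                      = ℚ.≤ᵇ⇒≤ tt , ℚ.≤ᵇ⇒≤ tt
... | tri> _ _ 0<q rewrite signℚ-pos 0<q = ℚ.≤ᵇ⇒≤ tt , ℚ.≤ᵇ⇒≤ tt

signℚ-*-bounds : ∀ q {μ} → 0ℚ ≤ℚ μ → - μ ≤ℚ signℚ q * μ × signℚ q * μ ≤ℚ μ
signℚ-*-bounds q {μ} 0≤μ with signℚ-bounds q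
... | -1≤s , s≤1 =
  subst (_≤ℚ signℚ q * μ) (-1*p≡-p μ) (ℚ.*-monoʳ-≤-nonNeg μ {{nonNegative 0≤μ}} -1≤s) ,
  subst (signℚ q * μ ≤ℚ_) (ℚ.*-identityˡ μ) (ℚ.*-monoʳ-≤-nonNeg μ {{nonNegative 0≤μ}} s≤1)
  where -1*p≡-p : ∀ p → - 1ℚ * p ≡ - p
        -1*p≡-p = solve-∀ ℚ-ring

∣∣-pos : ∀ {p} → 0ℚ < p → ∣ p ∣ ≡ p
∣∣-pos 0<p = ℚ.0≤p⇒∣p∣≡p (ℚ.<⇒≤ 0<p)

∣∣-nonPos : ∀ {p} → p ≤ℚ 0ℚ → ∣ p ∣ ≡ - p
∣∣-nonPos {p} p≤0 = trans (sym (ℚ.∣-p∣≡∣p∣ p)) (ℚ.0≤p⇒∣p∣≡p (ℚ.neg-antimono-≤ p≤0))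

sumOver : List A → (A → ℚ) → ℚ
sumOver xs f = sumℚ (map f xs)

infix 9 sumOver
syntax sumOver xs (λ x → e) = Σ[ x ∈ xs ] e

sum-++ : ∀ (f : A → ℚ) xs ys → Σ[ x ∈ xs ++ ys ] f x ≡ Σ[ x ∈ xs ] f x + Σ[ x ∈ ys ] f x
sum-++ f []       ys = sym (ℚ.+-identityˡ _)
sum-++ f (x ∷ xs) ys = trans (cong (f x +_) (sum-++ f xs ys)) (sym (ℚ.+-assoc (f x) _ _))

sum-cong : ∀ {f g : A → ℚ} xs → (∀ x → f x ≡ g x) → Σ[ x ∈ xs ] f x ≡ Σ[ x ∈ xs ] g x
sum-cong []       f≗g = refl
sum-cong (x ∷ xs) f≗g = cong₂ _+_ (f≗g x) (sum-cong xs f≗g)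

sum-zero : ∀ (xs : List A) → Σ[ x ∈ xs ] 0ℚ ≡ 0ℚ
sum-zero []       = refl
sum-zero (x ∷ xs) = trans (ℚ.+-identityˡ _) (sum-zero xs)

sum-+ : ∀ (f g : A → ℚ) xs → Σ[ x ∈ xs ] (f x + g x) ≡ Σ[ x ∈ xs ] f x + Σ[ x ∈ xs ] g x
sum-+ f g []       = refl
sum-+ f g (x ∷ xs) = trans (cong (f x + g x +_) (sum-+ f g xs)) (+-interchange (f x) (g x) _ _)

sum-*ˡ : ∀ c (f : A → ℚ) xs → Σ[ x ∈ xs ] (c * f x) ≡ c * Σ[ x ∈ xs ] f x
sum-*ˡ c f []       = sym (ℚ.*-zeroʳ c)
sum-*ˡ c f (x ∷ xs) = trans (cong (c * f x +_) (sum-*ˡ c f xs)) (sym (ℚ.*-distribˡ-+ c _ _))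

sum-linear : ∀ a c (f g : A → ℚ) xs →
             Σ[ x ∈ xs ] (a * f x + c * g x) ≡ a * Σ[ x ∈ xs ] f x + c * Σ[ x ∈ xs ] g x
sum-linear a c f g xs = trans (sum-+ (λ x → a * f x) (λ x → c * g x) xs) (cong₂ _+_ (sum-*ˡ a f xs) (sum-*ˡ c g xs))

sum-mono : ∀ {f g : A → ℚ} xs → (∀ x → f x ≤ℚ g x) → Σ[ x ∈ xs ] f x ≤ℚ Σ[ x ∈ xs ] g x
sum-mono []       f≤g = ℚ.≤-refl
sum-mono (x ∷ xs) f≤g = ℚ.+-mono-≤ (f≤g x) (sum-mono xs f≤g)

sum-map : ∀ (f : B → ℚ) (g : A → B) xs → Σ[ y ∈ map g xs ] f y ≡ Σ[ x ∈ xs ] f (g x)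
sum-map f g xs = cong sumℚ (sym (List.map-∘ xs))

sum-filter : ∀ (P : A → Bool) (f : A → ℚ) → (∀ x → P x ≡ false → f x ≡ 0ℚ) →
             ∀ xs → Σ[ x ∈ filterᵇ P xs ] f x ≡ Σ[ x ∈ xs ] f x
sum-filter P f f≡0 []       = refl
sum-filter P f f≡0 (x ∷ xs) with P x in Px
... | true  = cong (f x +_) (sum-filter P f f≡0 xs)
... | false = begin
  Σ[ y ∈ filterᵇ P xs ] f y  ≡⟨ sum-filter P f f≡0 xs ⟩
  Σ[ y ∈ xs ] f y            ≡⟨ ℚ.+-identityˡ _ ⟨
  0ℚ + Σ[ y ∈ xs ] f y       ≡⟨ cong (_+ Σ[ y ∈ xs ] f y) (f≡0 x Px) ⟨
  f x + Σ[ y ∈ xs ] f y      ∎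
  where open ≡-Reasoning

sum-swap : ∀ (h : A → B → ℚ) xs ys → Σ[ x ∈ xs ] Σ[ y ∈ ys ] h x y ≡ Σ[ y ∈ ys ] Σ[ x ∈ xs ] h x y
sum-swap h []       ys = sym (sum-zero ys)
sum-swap h (x ∷ xs) ys =
  trans (cong (Σ[ y ∈ ys ] h x y +_) (sum-swap h xs ys)) (sym (sum-+ (h x) (λ y → Σ[ x′ ∈ xs ] h x′ y) ys))

module _ {p g : A → ℚ} (p≥0 : ∀ x → 0ℚ ≤ℚ p x) where

  private
    p≡0 : ∀ x → ¬ 0ℚ < p x → p x ≡ 0ℚ
    p≡0 x 0≮p = ℚ.≤-antisym (ℚ.≮⇒≥ 0≮p) (p≥0 x)

  weighted-sum-nonNeg : (∀ x → 0ℚ < p x → 0ℚ ≤ℚ g x) → ∀ xs → 0ℚ ≤ℚ Σ[ x ∈ xs ] (p x * g x)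
  weighted-sum-nonNeg g≥0 xs = subst (_≤ℚ Σ[ x ∈ xs ] (p x * g x)) (sum-zero xs) (sum-mono xs term≥0)
    where
    term≥0 : ∀ x → 0ℚ ≤ℚ p x * g x
    term≥0 x with 0ℚ ℚ.<? p x
    ... | yes 0<p = *-nonNeg (p≥0 x) (g≥0 x 0<p)
    ... | no  0≮p = ℚ.≤-reflexive (sym (trans (cong (_* g x) (p≡0 x 0≮p)) (ℚ.*-zeroˡ (g x))))

  weighted-sum-pos : (∀ x → 0ℚ < p x → 0ℚ < g x) →
                     ∀ xs → 0ℚ < Σ[ x ∈ xs ] p x → 0ℚ < Σ[ x ∈ xs ] (p x * g x)
  weighted-sum-pos g>0 []       0<0 = ⊥-elim (ℚ.<-irrefl refl 0<0)
  weighted-sum-pos g>0 (x ∷ xs) 0<Σp with 0ℚ ℚ.<? p x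
  ... | yes 0<p = ℚ.+-mono-<-≤ (*-pos 0<p (g>0 x 0<p)) (weighted-sum-nonNeg (λ y → ℚ.<⇒≤ ∘ g>0 y) xs)
  ... | no  0≮p = subst (0ℚ <_) (sym (drop-head (p x * g x) (trans (cong (_* g x) px≡0) (ℚ.*-zeroˡ (g x)))))
                        (weighted-sum-pos g>0 xs (subst (0ℚ <_) (drop-head (p x) px≡0) 0<Σp))
    where
    px≡0 : p x ≡ 0ℚ
    px≡0 = p≡0 x 0≮p
    drop-head : ∀ {s} a → a ≡ 0ℚ → a + s ≡ s
    drop-head {s} a a≡0 = trans (cong (_+ s) a≡0) (ℚ.+-identityˡ s)

-- The Boolean cube and its subsets

sum-cube-suc : ∀ n {f : (Fin (suc n) → Bool) → ℚ} (H : Bool → (Fin n → Bool) → ℚ) →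
               (∀ x → f x ≡ H (head x) (tail x)) →
               Σ[ x ∈ cube (suc n) ] f x ≡ Σ[ v ∈ cube n ] H true v + Σ[ v ∈ cube n ] H false v
sum-cube-suc n {f} H f≡H = begin
  Σ[ x ∈ cube (suc n) ] f x                              ≡⟨ sum-cong (cube (suc n)) f≡H ⟩
  Σ[ x ∈ cube (suc n) ] H (head x) (tail x)              ≡⟨ sum-++ _ (map _ (cube n)) (map _ (cube n)) ⟩
  Σ[ x ∈ map _ (cube n) ] H (head x) (tail x) +
  Σ[ x ∈ map _ (cube n) ] H (head x) (tail x)            ≡⟨ cong₂ _+_ (sum-map _ _ (cube n)) (sum-map _ _ (cube n)) ⟩
  Σ[ v ∈ cube n ] H true v + Σ[ v ∈ cube n ] H false v   ∎
  where open ≡-Reasoning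

allFin-suc : ∀ n → allFin (suc n) ≡ zero ∷ map suc (allFin n)
allFin-suc n = cong (zero ∷_) (sym (List.map-tabulate (λ i → i) suc))

sumFin-suc : ∀ n (g : Fin (suc n) → ℚ) → sumFin (suc n) g ≡ g zero + sumFin n (g ∘ suc)
sumFin-suc n g = trans (cong (λ is → Σ[ i ∈ is ] g i) (allFin-suc n)) (cong (g zero +_) (sum-map g suc (allFin n)))

filterᵇ-map : ∀ (P : B → Bool) (f : A → B) xs → filterᵇ P (map f xs) ≡ map f (filterᵇ (P ∘ f) xs)
filterᵇ-map P f []       = refl
filterᵇ-map P f (x ∷ xs) with P (f x)
... | true  = cong (f x ∷_) (filterᵇ-map P f xs)
... | false = filterᵇ-map P f xs

members-suc : ∀ {n} (S : Fin (suc n) → Bool) →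
              members S ≡ (if head S then zero ∷ map suc (members (tail S)) else map suc (members (tail S)))
members-suc {n} S = trans (cong (filterᵇ S) (allFin-suc n)) split-head
  where
  split-head : filterᵇ S (zero ∷ map suc (allFin n)) ≡
               (if head S then zero ∷ map suc (members (tail S)) else map suc (members (tail S)))
  split-head with S zero
  ... | true  = cong (zero ∷_) (filterᵇ-map S suc (allFin n))
  ... | false = filterᵇ-map S suc (allFin n)

size : ∀ {n} → (Fin n → Bool) → ℕ
size S = length (members S)

size-suc : ∀ {n} (S : Fin (suc n) → Bool) → size S ≡ (if head S then suc (size (tail S)) else size (tail S))
size-suc S with head S | members-suc S
... | true  | eq = trans (cong length eq) (cong suc (List.length-map suc (members (tail S))))
... | false | eq = trans (cong length eq) (List.length-map suc (members (tail S)))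

size≤ : ∀ {n} (S : Fin n → Bool) → size S ℕ.≤ n
size≤ {n} S = subst (size S ℕ.≤_) (List.length-tabulate (λ i → i)) (List.length-filter (T? ∘ S) (allFin n))

size-prefix : ∀ n a → size {n} (λ j → toℕ j ℕ.<ᵇ a) ≡ a ℕ.⊓ n
size-prefix zero    zero    = refl
size-prefix zero    (suc a) = refl
size-prefix (suc n) zero    = trans (size-suc {n} (λ j → toℕ j ℕ.<ᵇ 0)) (size-prefix n zero)
size-prefix (suc n) (suc a) = trans (size-suc {n} (λ j → toℕ j ℕ.<ᵇ suc a)) (cong suc (size-prefix n a))

kronecker : ℕ → ℕ → ℚ
kronecker j l = if j ℕ.≡ᵇ l then 1ℚ else 0ℚ

kronecker-refl : ∀ j → kronecker j j ≡ 1ℚ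
kronecker-refl zero    = refl
kronecker-refl (suc j) = kronecker-refl j

kronecker-≢ : ∀ {j l} → j ≢ l → kronecker j l ≡ 0ℚ
kronecker-≢ j≢l = cong (if_then 1ℚ else 0ℚ) (¬-not (j≢l ∘ ℕ.≡ᵇ⇒≡ _ _ ∘ Equivalence.from T-≡))

kronecker-oversize : ∀ {n} (S : Fin n → Bool) → kronecker (suc n) (size S) ≡ 0ℚ
kronecker-oversize S = kronecker-≢ (ℕ.<⇒≢ (ℕ.s≤s (size≤ S)) ∘ sym)

kronecker-0-if : ∀ b l → kronecker 0 (if b then suc l else l) ≡ (if b then 0ℚ else 1ℚ) * kronecker 0 l
kronecker-0-if true  l = sym (ℚ.*-zeroˡ (kronecker 0 l))
kronecker-0-if false l = sym (ℚ.*-identityˡ (kronecker 0 l))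

kronecker-full-if : ∀ {n} b (v : Fin n → Bool) →
  kronecker (suc n) (if b then suc (size v) else size v) ≡ (if b then 1ℚ else 0ℚ) * kronecker n (size v)
kronecker-full-if {n} true  v = sym (ℚ.*-identityˡ (kronecker n (size v)))
kronecker-full-if {n} false v = trans (kronecker-oversize v) (sym (ℚ.*-zeroˡ (kronecker n (size v))))

kronecker-full-absent : ∀ {n} (v : Fin n → Bool) a → v a ≡ false → kronecker n (size v) ≡ 0ℚ
kronecker-full-absent {suc n} v a va≡false =
  trans (cong (kronecker (suc n)) (size-suc v)) (trans (kronecker-full-if (head v) (tail v)) (absent a va≡false))
  where
  absent : ∀ a → v a ≡ false → (if head v then 1ℚ else 0ℚ) * kronecker n (size (tail v)) ≡ 0ℚ
  absent zero    v₀≡false = trans (cong (λ c → (if c then 1ℚ else 0ℚ) * kronecker n (size (tail v))) v₀≡false)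
                                  (ℚ.*-zeroˡ (kronecker n (size (tail v))))
  absent (suc a) va≡false = trans (cong ((if head v then 1ℚ else 0ℚ) *_) (kronecker-full-absent (tail v) a va≡false))
                                  (ℚ.*-zeroʳ (if head v then 1ℚ else 0ℚ))

0<nCk : ∀ {n k} → k ℕ.≤ n → 0 ℕ.< n C k
0<nCk {n}     {zero}  _            = ℕ.s≤s ℕ.z≤n
0<nCk {suc n} {suc k} (ℕ.s≤s k≤n) =
  subst (0 ℕ.<_) (nCk+nC[k+1]≡[n+1]C[k+1] n k) (ℕ.<-≤-trans (0<nCk k≤n) (ℕ.m≤m+n (n C k) (n C suc k)))

count-size : ∀ n j → Σ[ v ∈ cube n ] kronecker j (size v) ≡ ℕtoℚ (n C j)
count-size zero    zero    = refl
count-size zero    (suc j) = refl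
count-size (suc n) j =
  trans (sum-cube-suc n (λ b v → kronecker j (if b then suc (size v) else size v)) (cong (kronecker j) ∘ size-suc))
        (pascal j)
  where
  pascal : ∀ j → Σ[ v ∈ cube n ] kronecker j (suc (size v)) + Σ[ v ∈ cube n ] kronecker j (size v) ≡ ℕtoℚ (suc n C j)
  pascal zero    = cong₂ _+_ (sum-zero (cube n)) (count-size n zero)
  pascal (suc j) = begin
    Σ[ v ∈ cube n ] kronecker j (size v) + Σ[ v ∈ cube n ] kronecker (suc j) (size v)
      ≡⟨ cong₂ _+_ (count-size n j) (count-size n (suc j)) ⟩
    ℕtoℚ (n C j) + ℕtoℚ (n C suc j)
      ≡⟨ ℕtoℚ-+ (n C j) (n C suc j) ⟨
    ℕtoℚ (n C j ℕ.+ n C suc j)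
      ≡⟨ cong ℕtoℚ (nCk+nC[k+1]≡[n+1]C[k+1] n j) ⟩
    ℕtoℚ (suc n C suc j) ∎
    where open ≡-Reasoning

singleton : ∀ {n} → (Fin n → ℚ) → List (Fin n) → ℚ
singleton g (i ∷ []) = g i
singleton g _        = 0ℚ

sum-singletons : ∀ n (g : Fin n → ℚ) → Σ[ v ∈ cube n ] singleton g (members v) ≡ sumFin n g
sum-singletons zero    g = refl
sum-singletons (suc n) g = begin
  Σ[ v ∈ cube (suc n) ] singleton g (members v)
    ≡⟨ sum-cube-suc n (λ b v → singleton g (if b then zero ∷ map suc (members v) else map suc (members v)))
                    (cong (singleton g) ∘ members-suc) ⟩
  Σ[ v ∈ cube n ] singleton g (zero ∷ map suc (members v)) + Σ[ v ∈ cube n ] singleton g (map suc (members v))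
    ≡⟨ cong₂ _+_ (sum-cong (cube n) (only-zero ∘ members)) (sum-cong (cube n) (shift ∘ members)) ⟩
  Σ[ v ∈ cube n ] (g zero * kronecker 0 (size v)) + Σ[ v ∈ cube n ] singleton (g ∘ suc) (members v)
    ≡⟨ cong₂ _+_ (trans (sum-*ˡ (g zero) _ (cube n)) (cong (g zero *_) (count-size n 0))) (sum-singletons n (g ∘ suc)) ⟩
  g zero * 1ℚ + sumFin n (g ∘ suc)
    ≡⟨ cong (_+ sumFin n (g ∘ suc)) (ℚ.*-identityʳ (g zero)) ⟩
  g zero + sumFin n (g ∘ suc)
    ≡⟨ sumFin-suc n g ⟨
  sumFin (suc n) g ∎
  where
  open ≡-Reasoning
  only-zero : ∀ is → singleton g (zero ∷ map suc is) ≡ g zero * kronecker 0 (length is)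
  only-zero []      = sym (ℚ.*-identityʳ (g zero))
  only-zero (_ ∷ _) = sym (ℚ.*-zeroʳ (g zero))
  shift : ∀ is → singleton g (map suc is) ≡ singleton (g ∘ suc) is
  shift []          = refl
  shift (_ ∷ [])    = refl
  shift (_ ∷ _ ∷ _) = refl

-- Fourier analysis on the cube

χ : ∀ {n} → (Fin n → Bool) → (Fin n → Bool) → ℚ
χ S v = monomial S (point v)

χ₁ : Bool → Bool → ℚ
χ₁ s b = if s then pm b else 1ℚ

χ-suc : ∀ {n} (S x : Fin (suc n) → Bool) → χ S x ≡ χ₁ (head S) (head x) * χ (tail S) (tail x)
χ-suc {n} S x = trans (cong (foldr factor 1ℚ) (allFin-suc n)) (cong (factor zero) (List.foldr-map factor suc 1ℚ (allFin n)))
  where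
  factor : Fin (suc n) → ℚ → ℚ
  factor i acc = (if S i then point x i else 1ℚ) * acc

negOnePow : ℕ → ℚ
negOnePow zero    = 1ℚ
negOnePow (suc t) = - negOnePow t

𝔼 : ∀ n → ((Fin n → Bool) → ℚ) → ℚ
𝔼 n f = half^ n * Σ[ v ∈ cube n ] f v

𝔼-cong : ∀ n {f g : (Fin n → Bool) → ℚ} → (∀ v → f v ≡ g v) → 𝔼 n f ≡ 𝔼 n g
𝔼-cong n f≗g = cong (half^ n *_) (sum-cong (cube n) f≗g)

𝔼-*ˡ : ∀ n c (f : (Fin n → Bool) → ℚ) → 𝔼 n (λ v → c * f v) ≡ c * 𝔼 n f
𝔼-*ˡ n c f = trans (cong (half^ n *_) (sum-*ˡ c f (cube n))) (x∙yz≈y∙xz (half^ n) c _)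

𝔼-linear : ∀ n a c (f g : (Fin n → Bool) → ℚ) → 𝔼 n (λ v → a * f v + c * g v) ≡ a * 𝔼 n f + c * 𝔼 n g
𝔼-linear n a c f g = trans (cong (half^ n *_) (sum-linear a c f g (cube n))) (distribute (half^ n) a c _ _)
  where distribute : ∀ h a c s t → h * (a * s + c * t) ≡ a * (h * s) + c * (h * t)
        distribute = solve-∀ ℚ-ring

𝔼-suc : ∀ n {f} (H : Bool → (Fin n → Bool) → ℚ) → (∀ x → f x ≡ H (head x) (tail x)) →
        𝔼 (suc n) f ≡ ½ * (𝔼 n (H true) + 𝔼 n (H false))
𝔼-suc n H f≡H = trans (cong (half^ (suc n) *_) (sum-cube-suc n H f≡H)) (halve (half^ n) _ _)
  where halve : ∀ h a b → ½ * h * (a + b) ≡ ½ * (h * a + h * b)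
        halve = solve-∀ ℚ-ring

𝔼-product : ∀ n (φ : Bool → ℚ) (ψ : (Fin n → Bool) → ℚ) →
            𝔼 (suc n) (λ x → φ (head x) * ψ (tail x)) ≡ ½ * (φ true + φ false) * 𝔼 n ψ
𝔼-product n φ ψ = begin
  𝔼 (suc n) (λ x → φ (head x) * ψ (tail x))
    ≡⟨ 𝔼-suc n (λ b v → φ b * ψ v) (λ _ → refl) ⟩
  ½ * (𝔼 n (λ v → φ true * ψ v) + 𝔼 n (λ v → φ false * ψ v))
    ≡⟨ cong (½ *_) (cong₂ _+_ (𝔼-*ˡ n (φ true) ψ) (𝔼-*ˡ n (φ false) ψ)) ⟩
  ½ * (φ true * 𝔼 n ψ + φ false * 𝔼 n ψ)
    ≡⟨ factor (φ true) (φ false) (𝔼 n ψ) ⟩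
  ½ * (φ true + φ false) * 𝔼 n ψ ∎
  where
  open ≡-Reasoning
  factor : ∀ a b e → ½ * (a * e + b * e) ≡ ½ * (a + b) * e
  factor = solve-∀ ℚ-ring

𝔼-χ : ∀ n (T : Fin n → Bool) → 𝔼 n (χ T) ≡ kronecker 0 (size T)
𝔼-χ zero    T = refl
𝔼-χ (suc n) T = begin
  𝔼 (suc n) (χ T)                                       ≡⟨ 𝔼-cong (suc n) (χ-suc T) ⟩
  𝔼 (suc n) (λ x → χ₁ s (head x) * χ T′ (tail x))        ≡⟨ 𝔼-product n (χ₁ s) (χ T′) ⟩
  ½ * (χ₁ s true + χ₁ s false) * 𝔼 n (χ T′)              ≡⟨ cong (½ * (χ₁ s true + χ₁ s false) *_) (𝔼-χ n T′) ⟩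
  ½ * (χ₁ s true + χ₁ s false) * kronecker 0 (size T′)   ≡⟨ mean s ⟩
  kronecker 0 (if s then suc (size T′) else size T′)     ≡⟨ cong (kronecker 0) (size-suc T) ⟨
  kronecker 0 (size T)                                   ∎
  where
  open ≡-Reasoning
  s : Bool
  s = head T
  T′ : Fin n → Bool
  T′ = tail T
  mean : ∀ s → ½ * (χ₁ s true + χ₁ s false) * kronecker 0 (size T′) ≡
               kronecker 0 (if s then suc (size T′) else size T′)
  mean true  = cancel (kronecker 0 (size T′))
    where cancel : ∀ k → ½ * (1ℚ + - 1ℚ) * k ≡ 0ℚ
          cancel = solve-∀ ℚ-ring
  mean false = average (kronecker 0 (size T′))
    where average : ∀ k → ½ * (1ℚ + 1ℚ) * k ≡ k
          average = solve-∀ ℚ-ring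

𝔼-empty-χ : ∀ n (T : Fin n → Bool) → 𝔼 n (λ v → kronecker 0 (size v) * χ T v) ≡ half^ n * negOnePow (size T)
𝔼-empty-χ zero    T = refl
𝔼-empty-χ (suc n) T = begin
  𝔼 (suc n) (λ x → kronecker 0 (size x) * χ T x)
    ≡⟨ 𝔼-cong (suc n) split ⟩
  𝔼 (suc n) (λ x → φ (head x) * (kronecker 0 (size (tail x)) * χ T′ (tail x)))
    ≡⟨ 𝔼-product n φ (λ v → kronecker 0 (size v) * χ T′ v) ⟩
  ½ * (φ true + φ false) * 𝔼 n (λ v → kronecker 0 (size v) * χ T′ v)
    ≡⟨ cong (½ * (φ true + φ false) *_) (𝔼-empty-χ n T′) ⟩
  ½ * (φ true + φ false) * (half^ n * negOnePow (size T′))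
    ≡⟨ mean s ⟩
  half^ (suc n) * negOnePow (if s then suc (size T′) else size T′)
    ≡⟨ cong (λ t → half^ (suc n) * negOnePow t) (size-suc T) ⟨
  half^ (suc n) * negOnePow (size T) ∎
  where
  open ≡-Reasoning
  s : Bool
  s = head T
  T′ : Fin n → Bool
  T′ = tail T
  φ : Bool → ℚ
  φ b = (if b then 0ℚ else 1ℚ) * χ₁ s b
  split : ∀ x → kronecker 0 (size x) * χ T x ≡ φ (head x) * (kronecker 0 (size (tail x)) * χ T′ (tail x))
  split x = trans (cong₂ _*_ (trans (cong (kronecker 0) (size-suc x)) (kronecker-0-if (head x) _)) (χ-suc T x))
                  (*-interchange (if head x then 0ℚ else 1ℚ) (kronecker 0 (size (tail x))) (χ₁ s (head x)) (χ T′ (tail x)))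
  mean : ∀ s → ½ * (0ℚ * χ₁ s true + 1ℚ * χ₁ s false) * (half^ n * negOnePow (size T′)) ≡
               half^ (suc n) * negOnePow (if s then suc (size T′) else size T′)
  mean true  = flip (half^ n) (negOnePow (size T′))
    where flip : ∀ h p → ½ * (0ℚ * 1ℚ + 1ℚ * - 1ℚ) * (h * p) ≡ ½ * h * - p
          flip = solve-∀ ℚ-ring
  mean false = keep (half^ n) (negOnePow (size T′))
    where keep : ∀ h p → ½ * (0ℚ * 1ℚ + 1ℚ * 1ℚ) * (h * p) ≡ ½ * h * p
          keep = solve-∀ ℚ-ring

𝔼-full-χ : ∀ n (T : Fin n → Bool) → 𝔼 n (λ v → kronecker n (size v) * χ T v) ≡ half^ n
𝔼-full-χ zero    T = refl
𝔼-full-χ (suc n) T = begin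
  𝔼 (suc n) (λ x → kronecker (suc n) (size x) * χ T x)
    ≡⟨ 𝔼-cong (suc n) split ⟩
  𝔼 (suc n) (λ x → φ (head x) * (kronecker n (size (tail x)) * χ T′ (tail x)))
    ≡⟨ 𝔼-product n φ (λ v → kronecker n (size v) * χ T′ v) ⟩
  ½ * (φ true + φ false) * 𝔼 n (λ v → kronecker n (size v) * χ T′ v)
    ≡⟨ cong (½ * (φ true + φ false) *_) (𝔼-full-χ n T′) ⟩
  ½ * (φ true + φ false) * half^ n
    ≡⟨ mean s ⟩
  half^ (suc n) ∎
  where
  open ≡-Reasoning
  s : Bool
  s = head T
  T′ : Fin n → Bool
  T′ = tail T
  φ : Bool → ℚ
  φ b = (if b then 1ℚ else 0ℚ) * χ₁ s b
  split : ∀ x → kronecker (suc n) (size x) * χ T x ≡ φ (head x) * (kronecker n (size (tail x)) * χ T′ (tail x))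
  split x = trans (cong₂ _*_ (trans (cong (kronecker (suc n)) (size-suc x)) (kronecker-full-if (head x) (tail x))) (χ-suc T x))
                  (*-interchange (if head x then 1ℚ else 0ℚ) (kronecker n (size (tail x))) (χ₁ s (head x)) (χ T′ (tail x)))
  mean : ∀ s → ½ * (1ℚ * χ₁ s true + 0ℚ * χ₁ s false) * half^ n ≡ half^ (suc n)
  mean true  = halve (half^ n)
    where halve : ∀ h → ½ * (1ℚ * 1ℚ + 0ℚ * - 1ℚ) * h ≡ ½ * h
          halve = solve-∀ ℚ-ring
  mean false = halve (half^ n)
    where halve : ∀ h → ½ * (1ℚ * 1ℚ + 0ℚ * 1ℚ) * h ≡ ½ * h
          halve = solve-∀ ℚ-ring

-- The monarchy predicate

monarchyValue : ℕ → Bool → ℕ → ℚ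
monarchyValue n true  c = 1ℚ - (kronecker 0 c + kronecker 0 c)
monarchyValue n false c = (kronecker n c + kronecker n c) - 1ℚ

citizen-sum : ∀ n (v : Fin n → Bool) →
              sumFin n (λ i → 1ℚ * point v i) ≡ ℕtoℚ (size v) + ℕtoℚ (size v) - ℕtoℚ n
citizen-sum zero    v = refl
citizen-sum (suc n) v = begin
  sumFin (suc n) (λ i → 1ℚ * point v i)                       ≡⟨ sumFin-suc n (λ i → 1ℚ * point v i) ⟩
  1ℚ * pm (head v) + sumFin n (λ i → 1ℚ * point (tail v) i)   ≡⟨ cong (1ℚ * pm (head v) +_) (citizen-sum n (tail v)) ⟩
  1ℚ * pm (head v) + (ℕtoℚ c + ℕtoℚ c - ℕtoℚ n)               ≡⟨ count-head (head v) ⟩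
  ℕtoℚ (c′ (head v)) + ℕtoℚ (c′ (head v)) - ℕtoℚ (suc n)      ≡⟨ cong (λ c′ → ℕtoℚ c′ + ℕtoℚ c′ - ℕtoℚ (suc n)) (size-suc v) ⟨
  ℕtoℚ (size v) + ℕtoℚ (size v) - ℕtoℚ (suc n)                ∎
  where
  open ≡-Reasoning
  c : ℕ
  c = size (tail v)
  c′ : Bool → ℕ
  c′ b = if b then suc c else c
  count-head : ∀ b → 1ℚ * pm b + (ℕtoℚ c + ℕtoℚ c - ℕtoℚ n) ≡
                     ℕtoℚ (c′ b) + ℕtoℚ (c′ b) - ℕtoℚ (suc n)
  count-head true  = trans (yes-vote (ℕtoℚ c) (ℕtoℚ n))
                           (sym (cong₂ (λ a b → a + a - b) (ℕtoℚ-suc c) (ℕtoℚ-suc n)))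
    where yes-vote : ∀ c n → 1ℚ * 1ℚ + (c + c - n) ≡ (1ℚ + c) + (1ℚ + c) - (1ℚ + n)
          yes-vote = solve-∀ ℚ-ring
  count-head false = trans (no-vote (ℕtoℚ c) (ℕtoℚ n)) (sym (cong (λ b → ℕtoℚ c + ℕtoℚ c - b) (ℕtoℚ-suc n)))
    where no-vote : ∀ c n → 1ℚ * - 1ℚ + (c + c - n) ≡ c + c - (1ℚ + n)
          no-vote = solve-∀ ℚ-ring

vote-sign : ∀ m b c → c ℕ.≤ suc m →
            signℚ (ℕtoℚ m * pm b + (ℕtoℚ c + ℕtoℚ c - ℕtoℚ (suc m))) ≡ monarchyValue (suc m) b c
vote-sign m true zero _ = cong signℚ (begin
  ℕtoℚ m * 1ℚ + (0ℚ + 0ℚ - ℕtoℚ (suc m))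
    ≡⟨ cong (λ n → ℕtoℚ m * 1ℚ + (0ℚ + 0ℚ - n)) (ℕtoℚ-suc m) ⟩
  ℕtoℚ m * 1ℚ + (0ℚ + 0ℚ - (1ℚ + ℕtoℚ m))
    ≡⟨ alone (ℕtoℚ m) ⟩
  - 1ℚ ∎)
  where
  open ≡-Reasoning
  alone : ∀ m → m * 1ℚ + (0ℚ + 0ℚ - (1ℚ + m)) ≡ - 1ℚ
  alone = solve-∀ ℚ-ring
vote-sign m true (suc c) _ = begin
  signℚ (ℕtoℚ m * 1ℚ + (ℕtoℚ (suc c) + ℕtoℚ (suc c) - ℕtoℚ (suc m)))
    ≡⟨ cong signℚ (cong₂ (λ a n → ℕtoℚ m * 1ℚ + (a + a - n)) (ℕtoℚ-suc c) (ℕtoℚ-suc m)) ⟩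
  signℚ (ℕtoℚ m * 1ℚ + ((1ℚ + ℕtoℚ c) + (1ℚ + ℕtoℚ c) - (1ℚ + ℕtoℚ m)))
    ≡⟨ cong signℚ (backed (ℕtoℚ m) (ℕtoℚ c)) ⟩
  signℚ (1ℚ + (ℕtoℚ c + ℕtoℚ c))
    ≡⟨ signℚ-pos (odd-pos c) ⟩
  1ℚ ∎
  where
  open ≡-Reasoning
  backed : ∀ m c → m * 1ℚ + ((1ℚ + c) + (1ℚ + c) - (1ℚ + m)) ≡ 1ℚ + (c + c)
  backed = solve-∀ ℚ-ring
vote-sign m false c c≤1+m with ℕ.m≤n⇒m<n∨m≡n c≤1+m
... | inj₂ refl = begin
  signℚ (ℕtoℚ m * - 1ℚ + (ℕtoℚ (suc m) + ℕtoℚ (suc m) - ℕtoℚ (suc m)))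
    ≡⟨ cong signℚ (cong (λ n → ℕtoℚ m * - 1ℚ + (n + n - n)) (ℕtoℚ-suc m)) ⟩
  signℚ (ℕtoℚ m * - 1ℚ + ((1ℚ + ℕtoℚ m) + (1ℚ + ℕtoℚ m) - (1ℚ + ℕtoℚ m)))
    ≡⟨ cong signℚ (unanimous (ℕtoℚ m)) ⟩
  1ℚ
    ≡⟨ cong (λ k → k + k - 1ℚ) (kronecker-refl (suc m)) ⟨
  monarchyValue (suc m) false (suc m) ∎
  where
  open ≡-Reasoning
  unanimous : ∀ m → m * - 1ℚ + ((1ℚ + m) + (1ℚ + m) - (1ℚ + m)) ≡ 1ℚ
  unanimous = solve-∀ ℚ-ring
... | inj₁ c<1+m with ℕ.m≤n⇒∃[o]m+o≡n (ℕ.≤-pred c<1+m)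
...   | d , refl = begin
  signℚ (ℕtoℚ (c ℕ.+ d) * - 1ℚ + (ℕtoℚ c + ℕtoℚ c - ℕtoℚ (suc (c ℕ.+ d))))
    ≡⟨ cong signℚ (cong₂ (λ a n → a * - 1ℚ + (ℕtoℚ c + ℕtoℚ c - n))
                         (ℕtoℚ-+ c d) (trans (ℕtoℚ-suc (c ℕ.+ d)) (cong (1ℚ +_) (ℕtoℚ-+ c d)))) ⟩
  signℚ ((ℕtoℚ c + ℕtoℚ d) * - 1ℚ + (ℕtoℚ c + ℕtoℚ c - (1ℚ + (ℕtoℚ c + ℕtoℚ d))))
    ≡⟨ cong signℚ (outvoted (ℕtoℚ c) (ℕtoℚ d)) ⟩
  signℚ (- (1ℚ + (ℕtoℚ d + ℕtoℚ d)))
    ≡⟨ signℚ-neg (ℚ.neg-antimono-< (odd-pos d)) ⟩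
  - 1ℚ
    ≡⟨ cong (λ k → k + k - 1ℚ) (kronecker-≢ (ℕ.<⇒≢ c<1+m ∘ sym)) ⟨
  monarchyValue (suc (c ℕ.+ d)) false c ∎
  where
  open ≡-Reasoning
  outvoted : ∀ c d → (c + d) * - 1ℚ + (c + c - (1ℚ + (c + d))) ≡ - (1ℚ + (d + d))
  outvoted = solve-∀ ℚ-ring

monarchy-value : ∀ m (x : Fin (suc (suc m)) → Bool) →
                 monarchy (suc (suc m)) (point x) ≡ monarchyValue (suc m) (head x) (size (tail x))
monarchy-value m x = begin
  signℚ (sumFin (suc (suc m)) (λ i → weight (suc (suc m)) i * point x i))
    ≡⟨ cong signℚ (sumFin-suc (suc m) (λ i → weight (suc (suc m)) i * point x i)) ⟩
  signℚ (ℕtoℚ m * pm (head x) + sumFin (suc m) (λ i → 1ℚ * point (tail x) i))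
    ≡⟨ cong (λ s → signℚ (ℕtoℚ m * pm (head x) + s)) (citizen-sum (suc m) (tail x)) ⟩
  signℚ (ℕtoℚ m * pm (head x) + (ℕtoℚ c + ℕtoℚ c - ℕtoℚ (suc m)))
    ≡⟨ vote-sign m (head x) c (size≤ (tail x)) ⟩
  monarchyValue (suc m) (head x) c ∎
  where
  open ≡-Reasoning
  c : ℕ
  c = size (tail x)

opposed-pair : ∀ m (x : Fin (suc (suc m)) → Bool) a → x zero ≡ false → x (suc a) ≡ false →
               monarchy (suc (suc m)) (point x) ≡ - 1ℚ
opposed-pair m x a x₀≡false xₐ≡false = begin
  monarchy (suc (suc m)) (point x)
    ≡⟨ monarchy-value m x ⟩
  monarchyValue (suc m) (head x) (size (tail x))
    ≡⟨ cong (λ s → monarchyValue (suc m) s (size (tail x))) x₀≡false ⟩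
  kronecker (suc m) (size (tail x)) + kronecker (suc m) (size (tail x)) - 1ℚ
    ≡⟨ cong (λ c → c + c - 1ℚ) (kronecker-full-absent (tail x) a xₐ≡false) ⟩
  0ℚ + 0ℚ - 1ℚ ∎
  where open ≡-Reasoning

vote-pair-nonNeg : ∀ m (x : Fin (suc (suc m)) → Bool) a → monarchy (suc (suc m)) (point x) ≡ 1ℚ →
                   0ℚ ≤ℚ pm (x (suc a)) + pm (x zero)
vote-pair-nonNeg m x a f≡1 = pair (x zero) (x (suc a)) refl refl
  where
  pair : ∀ s t → x zero ≡ s → x (suc a) ≡ t → 0ℚ ≤ℚ pm t + pm s
  pair true  true  _ _ = ℚ.≤ᵇ⇒≤ tt
  pair true  false _ _ = ℚ.≤ᵇ⇒≤ tt
  pair false true  _ _ = ℚ.≤ᵇ⇒≤ tt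
  pair false false x₀≡false xₐ≡false with () ← trans (sym f≡1) (opposed-pair m x a x₀≡false xₐ≡false)

𝔼-president-for : ∀ n (T : Fin n → Bool) → 𝔼 n (λ v → monarchyValue n true (size v) * χ T v) ≡
                  kronecker 0 (size T) - (half^ n * negOnePow (size T) + half^ n * negOnePow (size T))
𝔼-president-for n T = begin
  𝔼 n (λ v → monarchyValue n true (size v) * χ T v)
    ≡⟨ 𝔼-cong n (λ v → expand (kronecker 0 (size v)) (χ T v)) ⟩
  𝔼 n (λ v → 1ℚ * χ T v + - (1ℚ + 1ℚ) * (kronecker 0 (size v) * χ T v))
    ≡⟨ 𝔼-linear n 1ℚ (- (1ℚ + 1ℚ)) (χ T) (λ v → kronecker 0 (size v) * χ T v) ⟩
  1ℚ * 𝔼 n (χ T) + - (1ℚ + 1ℚ) * 𝔼 n (λ v → kronecker 0 (size v) * χ T v)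
    ≡⟨ cong₂ (λ e a → 1ℚ * e + - (1ℚ + 1ℚ) * a) (𝔼-χ n T) (𝔼-empty-χ n T) ⟩
  1ℚ * kronecker 0 (size T) + - (1ℚ + 1ℚ) * (half^ n * negOnePow (size T))
    ≡⟨ collect (kronecker 0 (size T)) (half^ n * negOnePow (size T)) ⟩
  kronecker 0 (size T) - (half^ n * negOnePow (size T) + half^ n * negOnePow (size T)) ∎
  where
  open ≡-Reasoning
  expand : ∀ k y → (1ℚ - (k + k)) * y ≡ 1ℚ * y + - (1ℚ + 1ℚ) * (k * y)
  expand = solve-∀ ℚ-ring
  collect : ∀ e a → 1ℚ * e + - (1ℚ + 1ℚ) * a ≡ e - (a + a)
  collect = solve-∀ ℚ-ring

𝔼-president-against : ∀ n (T : Fin n → Bool) → 𝔼 n (λ v → monarchyValue n false (size v) * χ T v) ≡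
                      (half^ n + half^ n) - kronecker 0 (size T)
𝔼-president-against n T = begin
  𝔼 n (λ v → monarchyValue n false (size v) * χ T v)
    ≡⟨ 𝔼-cong n (λ v → expand (kronecker n (size v)) (χ T v)) ⟩
  𝔼 n (λ v → (1ℚ + 1ℚ) * (kronecker n (size v) * χ T v) + - 1ℚ * χ T v)
    ≡⟨ 𝔼-linear n (1ℚ + 1ℚ) (- 1ℚ) (λ v → kronecker n (size v) * χ T v) (χ T) ⟩
  (1ℚ + 1ℚ) * 𝔼 n (λ v → kronecker n (size v) * χ T v) + - 1ℚ * 𝔼 n (χ T)
    ≡⟨ cong₂ (λ a e → (1ℚ + 1ℚ) * a + - 1ℚ * e) (𝔼-full-χ n T) (𝔼-χ n T) ⟩
  (1ℚ + 1ℚ) * half^ n + - 1ℚ * kronecker 0 (size T)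
    ≡⟨ collect (half^ n) (kronecker 0 (size T)) ⟩
  (half^ n + half^ n) - kronecker 0 (size T) ∎
  where
  open ≡-Reasoning
  expand : ∀ k y → (k + k - 1ℚ) * y ≡ (1ℚ + 1ℚ) * (k * y) + - 1ℚ * y
  expand = solve-∀ ℚ-ring
  collect : ∀ h e → (1ℚ + 1ℚ) * h + - 1ℚ * e ≡ (h + h) - e
  collect = solve-∀ ℚ-ring

coefficient : ℕ → Bool → ℕ → ℚ
coefficient n true  t = kronecker 0 t - half^ n * (1ℚ + negOnePow t)
coefficient n false t = half^ n * (1ℚ - negOnePow t)

fourier-monarchy : ∀ m (S : Fin (suc (suc m)) → Bool) →
                   fourier (suc (suc m)) (monarchy (suc (suc m))) S ≡ coefficient (suc m) (head S) (size (tail S))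
fourier-monarchy m S = begin
  𝔼 (suc n) (λ x → monarchy (suc n) (point x) * χ S x)
    ≡⟨ 𝔼-suc n H split ⟩
  ½ * (𝔼 n (H true) + 𝔼 n (H false))
    ≡⟨ cong (½ *_) (cong₂ _+_ (𝔼-*ˡ n (χ₁ s true) (vote true)) (𝔼-*ˡ n (χ₁ s false) (vote false))) ⟩
  ½ * (χ₁ s true * 𝔼 n (vote true) + χ₁ s false * 𝔼 n (vote false))
    ≡⟨ cong (½ *_) (cong₂ (λ a b → χ₁ s true * a + χ₁ s false * b)
                          (𝔼-president-for n T) (𝔼-president-against n T)) ⟩
  ½ * (χ₁ s true * (e - (hp + hp)) + χ₁ s false * ((h + h) - e))
    ≡⟨ combine s ⟩
  coefficient n s (size T) ∎
  where
  open ≡-Reasoning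
  n : ℕ
  n = suc m
  s : Bool
  s = head S
  T : Fin n → Bool
  T = tail S
  h e hp : ℚ
  h = half^ n
  e = kronecker 0 (size T)
  hp = half^ n * negOnePow (size T)
  vote : Bool → (Fin n → Bool) → ℚ
  vote b v = monarchyValue n b (size v) * χ T v
  H : Bool → (Fin n → Bool) → ℚ
  H b v = χ₁ s b * vote b v
  split : ∀ x → monarchy (suc n) (point x) * χ S x ≡ H (head x) (tail x)
  split x = trans (cong₂ _*_ (monarchy-value m x) (χ-suc S x))
                  (x∙yz≈y∙xz (monarchyValue n (head x) (size (tail x))) (χ₁ s (head x)) (χ T (tail x)))
  combine : ∀ s → ½ * (χ₁ s true * (e - (hp + hp)) + χ₁ s false * ((h + h) - e)) ≡ coefficient n s (size T)
  combine true  = for e h (negOnePow (size T))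
    where for : ∀ e h p → ½ * (1ℚ * (e - (h * p + h * p)) + - 1ℚ * ((h + h) - e)) ≡ e - h * (1ℚ + p)
          for = solve-∀ ℚ-ring
  combine false = against e h (negOnePow (size T))
    where against : ∀ e h p → ½ * (1ℚ * (e - (h * p + h * p)) + 1ℚ * ((h + h) - e)) ≡ h * (1ℚ - p)
          against = solve-∀ ℚ-ring

-- The constant C

δ : ℕ → ℚ
δ n = half^ n + half^ n

coefficient-P : ∀ n → coefficient n true 0 ≡ 1ℚ - δ n
coefficient-P n = eq (half^ n)
  where eq : ∀ h → 1ℚ - h * (1ℚ + 1ℚ) ≡ 1ℚ - (h + h)
        eq = solve-∀ ℚ-ring

coefficient-C : ∀ n → coefficient n false 1 ≡ δ n
coefficient-C n = eq (half^ n)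
  where eq : ∀ h → h * (1ℚ - - 1ℚ) ≡ h + h
        eq = solve-∀ ℚ-ring

coefficient-P+2C : ∀ n → coefficient n true 2 ≡ - δ n
coefficient-P+2C n = eq (half^ n)
  where eq : ∀ h → 0ℚ - h * (1ℚ + - - 1ℚ) ≡ - (h + h)
        eq = solve-∀ ℚ-ring

coefficient-3C : ∀ n → coefficient n false 3 ≡ δ n
coefficient-3C n = eq (half^ n)
  where eq : ∀ h → h * (1ℚ - - - - 1ℚ) ≡ h + h
        eq = solve-∀ ℚ-ring

half^-pos : ∀ n → 0ℚ < half^ n
half^-pos zero    = ℚ.positive⁻¹ 1ℚ
half^-pos (suc n) = *-pos (ℚ.positive⁻¹ ½) (half^-pos n)

δ-pos : ∀ n → 0ℚ < δ n
δ-pos n = ℚ.+-mono-< (half^-pos n) (half^-pos n)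

δ-suc : ∀ n → δ (suc n) ≡ half^ n
δ-suc n = halves (half^ n)
  where halves : ∀ h → ½ * h + ½ * h ≡ h
        halves = solve-∀ ℚ-ring

[1+n]*half^n≤1 : ∀ n → ℕtoℚ (suc n) * half^ n ≤ℚ 1ℚ
[1+n]*half^n≤1 zero    = ℚ.≤ᵇ⇒≤ tt
[1+n]*half^n≤1 (suc n) = begin
  ℕtoℚ (suc (suc n)) * half^ (suc n)
    ≤⟨ p≤p+q _ (*-nonNeg (ℚ.<⇒≤ (ℚ.positive⁻¹ ½)) (*-nonNeg (ℕtoℚ-nonNeg n) (ℚ.<⇒≤ (half^-pos n)))) ⟩
  ℕtoℚ (suc (suc n)) * half^ (suc n) + ½ * (ℕtoℚ n * half^ n)
    ≡⟨ cong (λ c → c * half^ (suc n) + ½ * (ℕtoℚ n * half^ n))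
            (trans (ℕtoℚ-suc (suc n)) (cong (1ℚ +_) (ℕtoℚ-suc n))) ⟩
  (1ℚ + (1ℚ + ℕtoℚ n)) * (½ * half^ n) + ½ * (ℕtoℚ n * half^ n)
    ≡⟨ halve (ℕtoℚ n) (half^ n) ⟩
  (1ℚ + ℕtoℚ n) * half^ n
    ≡⟨ cong (_* half^ n) (ℕtoℚ-suc n) ⟨
  ℕtoℚ (suc n) * half^ n
    ≤⟨ [1+n]*half^n≤1 n ⟩
  1ℚ ∎
  where
  open ℚ.≤-Reasoning
  halve : ∀ c h → (1ℚ + (1ℚ + c)) * (½ * h) + ½ * (c * h) ≡ (1ℚ + c) * h
  halve = solve-∀ ℚ-ring

fhatC≡coefficient : ∀ m a → fhatC (suc (suc m)) a ≡ coefficient (suc m) false (a ℕ.⊓ suc m)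
fhatC≡coefficient m a =
  trans (fourier-monarchy m (citizensUpTo a)) (cong (coefficient (suc m) false) (size-prefix (suc m) a))

fhatPC≡coefficient : ∀ m a → fhatPC (suc (suc m)) a ≡ coefficient (suc m) true (a ℕ.⊓ suc m)
fhatPC≡coefficient m a =
  trans (fourier-monarchy m (withPresident (citizensUpTo a))) (cong (coefficient (suc m) true) (size-prefix (suc m) a))

-- With two citizens, citizensUpTo 3 has only two members, but its coefficient is weighted by C(2,3) = 0.
three-citizen-term : ∀ m → let n = suc (suc m) in fhatC (suc n) 3 * ℕtoℚ (n C 3) ≡ δ n * ℕtoℚ (n C 3)
three-citizen-term zero    = cong (_* ℕtoℚ (2 C 3)) (fhatC≡coefficient 1 3)
three-citizen-term (suc m) =
  cong (_* ℕtoℚ (suc (suc (suc m)) C 3)) (trans (fhatC≡coefficient (suc (suc m)) 3) (coefficient-3C (suc (suc (suc m)))))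

constC-value : ∀ m → let n = suc (suc m) in
               constC (suc n) ≡ (1ℚ - ℕtoℚ n * δ n) ÷′ (δ n * ℕtoℚ (suc n C 3))
constC-value m = cong₂ _÷′_ numerator denominator
  where
  open ≡-Reasoning
  n : ℕ
  n = suc (suc m)
  numerator : fhatPC (suc n) 0 - ℕtoℚ (suc m) * fhatC (suc n) 1 ≡ 1ℚ - ℕtoℚ n * δ n
  numerator = begin
    fhatPC (suc n) 0 - ℕtoℚ (suc m) * fhatC (suc n) 1
      ≡⟨ cong₂ (λ a b → a - ℕtoℚ (suc m) * b) (trans (fhatPC≡coefficient (suc m) 0) (coefficient-P n))
                                              (trans (fhatC≡coefficient (suc m) 1) (coefficient-C n)) ⟩
    (1ℚ - δ n) - ℕtoℚ (suc m) * δ n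
      ≡⟨ collect (δ n) (ℕtoℚ (suc m)) ⟩
    1ℚ - (1ℚ + ℕtoℚ (suc m)) * δ n
      ≡⟨ cong (λ c → 1ℚ - c * δ n) (ℕtoℚ-suc (suc m)) ⟨
    1ℚ - ℕtoℚ n * δ n ∎
    where collect : ∀ d c → (1ℚ - d) - c * d ≡ 1ℚ - (1ℚ + c) * d
          collect = solve-∀ ℚ-ring
  denominator : fhatC (suc n) 3 * ℕtoℚ (n C 3) - fhatPC (suc n) 2 * ℕtoℚ (n C 2) ≡ δ n * ℕtoℚ (suc n C 3)
  denominator = begin
    fhatC (suc n) 3 * ℕtoℚ (n C 3) - fhatPC (suc n) 2 * ℕtoℚ (n C 2)
      ≡⟨ cong₂ (λ a b → a - b * ℕtoℚ (n C 2)) (three-citizen-term m)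
               (trans (fhatPC≡coefficient (suc m) 2) (coefficient-P+2C n)) ⟩
    δ n * ℕtoℚ (n C 3) - (- δ n) * ℕtoℚ (n C 2)
      ≡⟨ collect (δ n) (ℕtoℚ (n C 2)) (ℕtoℚ (n C 3)) ⟩
    δ n * (ℕtoℚ (n C 2) + ℕtoℚ (n C 3))
      ≡⟨ cong (δ n *_) (trans (sym (ℕtoℚ-+ (n C 2) (n C 3))) (cong ℕtoℚ (nCk+nC[k+1]≡[n+1]C[k+1] n 2))) ⟩
    δ n * ℕtoℚ (suc n C 3) ∎
    where collect : ∀ d a b → d * b - (- d) * a ≡ d * (a + b)
          collect = solve-∀ ℚ-ring

module _ (m : ℕ) where

  private
    n : ℕ
    n = suc (suc m)

  denominator-pos : 0ℚ < δ n * ℕtoℚ (suc n C 3)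
  denominator-pos = *-pos (δ-pos n) (ℕtoℚ-pos (0<nCk {suc n} (ℕ.s≤s (ℕ.s≤s (ℕ.s≤s ℕ.z≤n)))))

  constC-nonNeg : 0ℚ ≤ℚ constC (suc n)
  constC-nonNeg = subst (0ℚ ≤ℚ_) (sym (constC-value m)) (÷′-nonNeg 0≤1-nδ denominator-pos)
    where
    nδ≤1 : ℕtoℚ n * δ n ≤ℚ 1ℚ
    nδ≤1 = subst (λ d → ℕtoℚ n * d ≤ℚ 1ℚ) (sym (δ-suc (suc m))) ([1+n]*half^n≤1 (suc m))
    0≤1-nδ : 0ℚ ≤ℚ 1ℚ - ℕtoℚ n * δ n
    0≤1-nδ = subst (_≤ℚ 1ℚ - ℕtoℚ n * δ n) (ℚ.+-inverseʳ (ℕtoℚ n * δ n))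
                   (ℚ.+-monoˡ-≤ (- (ℕtoℚ n * δ n)) nδ≤1)

  constC-equation : constC (suc n) * (δ n * ℕtoℚ (suc n C 3)) ≡ 1ℚ - ℕtoℚ n * δ n
  constC-equation = trans (cong (_* (δ n * ℕtoℚ (suc n C 3))) (constC-value m)) (÷′-cancelʳ _ denominator-pos)

signMin : ℚ → ℚ → ℚ → ℚ
signMin x y z = signℚ (x * y * z) * (∣ x ∣ ⊓ ∣ y ∣ ⊓ ∣ z ∣)

module _ (x y z : ℚ) where

  private
    μ : ℚ
    μ = ∣ x ∣ ⊓ ∣ y ∣ ⊓ ∣ z ∣

  min≤ˡ : μ ≤ℚ ∣ x ∣
  min≤ˡ = ℚ.≤-trans (ℚ.p⊓q≤p (∣ x ∣ ⊓ ∣ y ∣) ∣ z ∣) (ℚ.p⊓q≤p ∣ x ∣ ∣ y ∣)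

  min≤ᵐ : μ ≤ℚ ∣ y ∣
  min≤ᵐ = ℚ.≤-trans (ℚ.p⊓q≤p (∣ x ∣ ⊓ ∣ y ∣) ∣ z ∣) (ℚ.p⊓q≤q ∣ x ∣ ∣ y ∣)

  min≤ʳ : μ ≤ℚ ∣ z ∣
  min≤ʳ = ℚ.p⊓q≤q (∣ x ∣ ⊓ ∣ y ∣) ∣ z ∣

  min-glb : ∀ {t} → t ≤ℚ ∣ x ∣ → t ≤ℚ ∣ y ∣ → t ≤ℚ ∣ z ∣ → t ≤ℚ μ
  min-glb t≤x t≤y t≤z = ℚ.⊓-glb (ℚ.⊓-glb t≤x t≤y) t≤z

  min-nonNeg : 0ℚ ≤ℚ μ
  min-nonNeg = min-glb (ℚ.0≤∣p∣ x) (ℚ.0≤∣p∣ y) (ℚ.0≤∣p∣ z)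

  signMin-pos : 0ℚ < x → 0ℚ < y → 0ℚ < z → signMin x y z ≡ μ
  signMin-pos 0<x 0<y 0<z = trans (cong (_* μ) (signℚ-pos (*-pos (*-pos 0<x 0<y) 0<z))) (ℚ.*-identityˡ μ)

  signMin-neg : x < 0ℚ → 0ℚ < y → 0ℚ < z → signMin x y z ≡ - μ
  signMin-neg x<0 0<y 0<z = trans (cong (_* μ) (signℚ-neg xyz<0)) (-1*p≡-p μ)
    where
    xyz<0 : x * y * z < 0ℚ
    xyz<0 = ℚ.negative⁻¹ (x * y * z)
      {{ℚ.neg*pos⇒neg (x * y) {{ℚ.neg*pos⇒neg x {{negative x<0}} y {{positive 0<y}}}} z {{positive 0<z}}}}
    -1*p≡-p : ∀ p → - 1ℚ * p ≡ - p
    -1*p≡-p = solve-∀ ℚ-ring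

  signMin-≥-of-min≤ : ∀ {a} → μ ≤ℚ a → - a ≤ℚ signMin x y z
  signMin-≥-of-min≤ μ≤a = ℚ.≤-trans (ℚ.neg-antimono-≤ μ≤a) (proj₁ (signℚ-*-bounds (x * y * z) min-nonNeg))

pos-or-small : ∀ {a e} → - a ≤ℚ e → 0ℚ < e ⊎ ∣ e ∣ ≤ℚ a
pos-or-small {a} {e} -a≤e with 0ℚ ℚ.<? e
... | yes 0<e = inj₁ 0<e
... | no  0≮e = inj₂ (begin
  ∣ e ∣   ≡⟨ ∣∣-nonPos (ℚ.≮⇒≥ 0≮e) ⟩
  - e     ≤⟨ ℚ.neg-antimono-≤ -a≤e ⟩
  - - a   ≡⟨ neg-involutive a ⟩
  a       ∎)
  where open ℚ.≤-Reasoning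

signMin-≤ : ∀ {a x y} → - a ≤ℚ x → - a ≤ℚ y → signMin a x y ≤ℚ a
signMin-≤ {a} {x} {y} -a≤x -a≤y with 0ℚ ℚ.≤? a
... | yes 0≤a = begin
  signMin a x y           ≤⟨ proj₂ (signℚ-*-bounds (a * x * y) (min-nonNeg a x y)) ⟩
  ∣ a ∣ ⊓ ∣ x ∣ ⊓ ∣ y ∣   ≤⟨ min≤ˡ a x y ⟩
  ∣ a ∣                   ≡⟨ ℚ.0≤p⇒∣p∣≡p 0≤a ⟩
  a                       ∎
  where open ℚ.≤-Reasoning
... | no 0≰a = begin
  signMin a x y             ≡⟨ signMin-neg a x y a<0 0<x 0<y ⟩
  - (∣ a ∣ ⊓ ∣ x ∣ ⊓ ∣ y ∣)  ≤⟨ ℚ.neg-antimono-≤ -a≤μ ⟩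
  - - a                     ≡⟨ neg-involutive a ⟩
  a                         ∎
  where
  open ℚ.≤-Reasoning
  a<0 : a < 0ℚ
  a<0 = ℚ.≰⇒> 0≰a
  0<-a : 0ℚ < - a
  0<-a = ℚ.neg-antimono-< a<0
  0<x : 0ℚ < x
  0<x = ℚ.<-≤-trans 0<-a -a≤x
  0<y : 0ℚ < y
  0<y = ℚ.<-≤-trans 0<-a -a≤y
  -a≤μ : - a ≤ℚ ∣ a ∣ ⊓ ∣ x ∣ ⊓ ∣ y ∣
  -a≤μ = min-glb a x y (ℚ.≤-reflexive (sym (∣∣-nonPos (ℚ.<⇒≤ a<0))))
                       (subst (- a ≤ℚ_) (sym (∣∣-pos 0<x)) -a≤x) (subst (- a ≤ℚ_) (sym (∣∣-pos 0<y)) -a≤y)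

signMin-≥ : ∀ {a x y z} → - a ≤ℚ x → - a ≤ℚ y → - a ≤ℚ z → - a ≤ℚ signMin x y z
signMin-≥ {a} {x} {y} {z} -a≤x -a≤y -a≤z with 0ℚ ℚ.≤? a
... | no 0≰a = subst (- a ≤ℚ_) (sym (signMin-pos x y z 0<x 0<y 0<z))
                 (min-glb x y z (subst (- a ≤ℚ_) (sym (∣∣-pos 0<x)) -a≤x)
                                (subst (- a ≤ℚ_) (sym (∣∣-pos 0<y)) -a≤y)
                                (subst (- a ≤ℚ_) (sym (∣∣-pos 0<z)) -a≤z))
  where
  0<-a : 0ℚ < - a
  0<-a = ℚ.neg-antimono-< (ℚ.≰⇒> 0≰a)
  0<x : 0ℚ < x
  0<x = ℚ.<-≤-trans 0<-a -a≤x
  0<y : 0ℚ < y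
  0<y = ℚ.<-≤-trans 0<-a -a≤y
  0<z : 0ℚ < z
  0<z = ℚ.<-≤-trans 0<-a -a≤z
... | yes 0≤a with pos-or-small -a≤x | pos-or-small -a≤y | pos-or-small -a≤z
...   | inj₂ ∣x∣≤a | _          | _          = signMin-≥-of-min≤ x y z (ℚ.≤-trans (min≤ˡ x y z) ∣x∣≤a)
...   | inj₁ _     | inj₂ ∣y∣≤a | _          = signMin-≥-of-min≤ x y z (ℚ.≤-trans (min≤ᵐ x y z) ∣y∣≤a)
...   | inj₁ _     | inj₁ _     | inj₂ ∣z∣≤a = signMin-≥-of-min≤ x y z (ℚ.≤-trans (min≤ʳ x y z) ∣z∣≤a)
...   | inj₁ 0<x   | inj₁ 0<y   | inj₁ 0<z   =
  ℚ.≤-trans (ℚ.neg-antimono-≤ 0≤a) (subst (0ℚ ≤ℚ_) (sym (signMin-pos x y z 0<x 0<y 0<z)) (min-nonNeg x y z))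

moment : ∀ k → (Fin k → ℚ) → ℚ → List (Fin k) → ℚ
moment k b ε (i ∷ [])         = ε * b i
moment k b ε (i ∷ j ∷ l ∷ []) = constC k * ε * signMin (b i) (b j) (b l)
moment k b ε _                = 0ℚ

roundedMoment-members : ∀ k b ε (S : Fin k → Bool) → roundedMoment k b ε S ≡ moment k b ε (members S)
roundedMoment-members k b ε S with members S
... | []                = refl
... | _ ∷ []            = refl
... | _ ∷ _ ∷ []        = refl
... | i ∷ j ∷ l ∷ []    = ℚ.*-assoc (constC k * ε) (signℚ (b i * b j * b l)) (∣ b i ∣ ⊓ ∣ b j ∣ ⊓ ∣ b l ∣)
... | _ ∷ _ ∷ _ ∷ _ ∷ _ = refl

roundedAdvantage-cube : ∀ k p ε →
  roundedAdvantage k p ε ≡ Σ[ S ∈ cube k ] (fourier k (monarchy k) S * roundedMoment k (bias k p) ε S)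
roundedAdvantage-cube k p ε = sum-filter nonempty _ empty-term (cube k)
  where
  moment-[] : ∀ is → not (null is) ≡ false → moment k (bias k p) ε is ≡ 0ℚ
  moment-[] [] _ = refl
  empty-term : ∀ S → nonempty S ≡ false → fourier k (monarchy k) S * roundedMoment k (bias k p) ε S ≡ 0ℚ
  empty-term S S-empty =
    trans (cong (fourier k (monarchy k) S *_) (trans (roundedMoment-members k (bias k p) ε S) (moment-[] (members S) S-empty)))
          (ℚ.*-zeroʳ (fourier k (monarchy k) S))

module _ {m : ℕ} {p : (Fin (suc (suc m)) → Bool) → ℚ} (D : IsDistributionOn (suc (suc m)) p)
         (supported : ∀ x → 0ℚ < p x → monarchy (suc (suc m)) (point x) ≡ 1ℚ) where

  private
    k : ℕ
    k = suc (suc m)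
    open IsDistributionOn D

  bias-bound : ∀ a → - bias k p zero ≤ℚ bias k p (suc a)
  bias-bound a = 0≤p+q⇒-q≤p (subst (0ℚ ≤ℚ_) pair-sum
    (weighted-sum-nonNeg nonneg (λ x 0<p → vote-pair-nonNeg m x a (supported x 0<p)) (cube k)))
    where
    pair-sum : Σ[ x ∈ cube k ] (p x * (pm (x (suc a)) + pm (x zero))) ≡ bias k p (suc a) + bias k p zero
    pair-sum = trans (sum-cong (cube k) (λ x → ℚ.*-distribˡ-+ (p x) _ _)) (sum-+ _ _ (cube k))

  weighted-bias-pos : 0ℚ < sumFin k (λ i → weight k i * bias k p i)
  weighted-bias-pos = subst (0ℚ <_) (sym exchange)
    (weighted-sum-pos nonneg (λ x 0<p → signℚ≡1⇒pos (supported x 0<p)) (cube k)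
                             (subst (0ℚ <_) (sym sumOne) (ℚ.positive⁻¹ 1ℚ)))
    where
    exchange : sumFin k (λ i → weight k i * bias k p i) ≡ Σ[ x ∈ cube k ] (p x * sumFin k (λ i → weight k i * point x i))
    exchange = begin
      Σ[ i ∈ allFin k ] (weight k i * Σ[ x ∈ cube k ] (p x * point x i))
        ≡⟨ sum-cong (allFin k) (λ i → sum-*ˡ (weight k i) _ (cube k)) ⟨
      Σ[ i ∈ allFin k ] Σ[ x ∈ cube k ] (weight k i * (p x * point x i))
        ≡⟨ sum-swap (λ i x → weight k i * (p x * point x i)) (allFin k) (cube k) ⟩
      Σ[ x ∈ cube k ] Σ[ i ∈ allFin k ] (weight k i * (p x * point x i))
        ≡⟨ sum-cong (cube k) (λ x → sum-cong (allFin k) (λ i → x∙yz≈y∙xz (weight k i) (p x) (point x i))) ⟩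
      Σ[ x ∈ cube k ] Σ[ i ∈ allFin k ] (p x * (weight k i * point x i))
        ≡⟨ sum-cong (cube k) (λ x → sum-*ˡ (p x) _ (allFin k)) ⟩
      Σ[ x ∈ cube k ] (p x * sumFin k (λ i → weight k i * point x i)) ∎
      where open ≡-Reasoning

-- The lower bound, term by term

module _ (m : ℕ) (b : Fin (suc (suc (suc m))) → ℚ) (ε : ℚ) where

  private
    n : ℕ
    n = suc (suc m)
    b₀ Cε X Y : ℚ
    b₀ = b zero
    Cε = constC (suc n) * ε
    X = (1ℚ - δ n) * (ε * b₀)
    Y = - (δ n * (Cε * b₀))
    0≤δ : 0ℚ ≤ℚ δ n
    0≤δ = ℚ.<⇒≤ (δ-pos n)

  term : Bool → List (Fin n) → ℚ
  term s is = coefficient n s (length is) * moment (suc n) b ε (if s then zero ∷ map suc is else map suc is)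

  -- s tells whether the president is in S and is lists its citizens; singleton terms are kept
  -- exactly and every triple term is replaced by its lower bound Y.
  termBound : Bool → List (Fin n) → ℚ
  termBound true  is = X * kronecker 0 (length is) + Y * kronecker 2 (length is)
  termBound false is = δ n * singleton (λ a → ε * b (suc a)) is + Y * kronecker 3 (length is)

  fourier-term : ∀ (S : Fin (suc n) → Bool) →
                 fourier (suc n) (monarchy (suc n)) S * roundedMoment (suc n) b ε S ≡ term (head S) (members (tail S))
  fourier-term S = cong₂ _*_ (fourier-monarchy (suc m) S)
                             (trans (roundedMoment-members (suc n) b ε S) (cong (moment (suc n) b ε) (members-suc S)))

  termBound≤term : (∀ a → - b₀ ≤ℚ b (suc a)) → 0ℚ ≤ℚ Cε → ∀ s is → termBound s is ≤ℚ term s is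
  termBound≤term _ _ true [] = ℚ.≤-reflexive (begin-equality
    X * 1ℚ + Y * 0ℚ                   ≡⟨ x*1+y*0≡x X Y ⟩
    (1ℚ - δ n) * (ε * b₀)             ≡⟨ cong (_* (ε * b₀)) (coefficient-P n) ⟨
    coefficient n true 0 * (ε * b₀)   ∎)
    where open ℚ.≤-Reasoning
  termBound≤term _ _ true (_ ∷ []) = x*0+y*0≤z*0 X Y (coefficient n true 1)
  termBound≤term -b₀≤b 0≤Cε true (a ∷ c ∷ []) = begin
    X * 0ℚ + Y * 1ℚ                    ≡⟨ x*0+y*1≡y X Y ⟩
    - (δ n * (Cε * b₀))                ≤⟨ ℚ.neg-antimono-≤ (scale-≤ 0≤δ (scale-≤ 0≤Cε (signMin-≤ (-b₀≤b a) (-b₀≤b c)))) ⟩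
    - (δ n * (Cε * sm))                ≡⟨ ℚ.neg-distribˡ-* (δ n) (Cε * sm) ⟩
    - δ n * (Cε * sm)                  ≡⟨ cong (_* (Cε * sm)) (coefficient-P+2C n) ⟨
    coefficient n true 2 * (Cε * sm)   ∎
    where
    open ℚ.≤-Reasoning
    sm : ℚ
    sm = signMin b₀ (b (suc a)) (b (suc c))
  termBound≤term _ _ true (_ ∷ _ ∷ _ ∷ is) = x*0+y*0≤z*0 X Y (coefficient n true (3 ℕ.+ length is))
  termBound≤term _ _ false [] = x*0+y*0≤z*0 (δ n) Y (coefficient n false 0)
  termBound≤term _ _ false (a ∷ []) = ℚ.≤-reflexive (begin-equality
    δ n * (ε * b (suc a)) + Y * 0ℚ            ≡⟨ x+y*0≡x _ Y ⟩
    δ n * (ε * b (suc a))                     ≡⟨ cong (_* (ε * b (suc a))) (coefficient-C n) ⟨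
    coefficient n false 1 * (ε * b (suc a))   ∎)
    where open ℚ.≤-Reasoning
  termBound≤term _ _ false (_ ∷ _ ∷ []) = x*0+y*0≤z*0 (δ n) Y (coefficient n false 2)
  termBound≤term -b₀≤b 0≤Cε false (a ∷ c ∷ e ∷ []) = begin
    δ n * 0ℚ + Y * 1ℚ                   ≡⟨ x*0+y*1≡y (δ n) Y ⟩
    - (δ n * (Cε * b₀))                 ≡⟨ push-neg (δ n) Cε b₀ ⟩
    δ n * (Cε * - b₀)                   ≤⟨ scale-≤ 0≤δ (scale-≤ 0≤Cε (signMin-≥ (-b₀≤b a) (-b₀≤b c) (-b₀≤b e))) ⟩
    δ n * (Cε * sm)                     ≡⟨ cong (_* (Cε * sm)) (coefficient-3C n) ⟨
    coefficient n false 3 * (Cε * sm)   ∎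
    where
    open ℚ.≤-Reasoning
    sm : ℚ
    sm = signMin (b (suc a)) (b (suc c)) (b (suc e))
    push-neg : ∀ d c x → - (d * (c * x)) ≡ d * (c * - x)
    push-neg = solve-∀ ℚ-ring
  termBound≤term _ _ false (_ ∷ _ ∷ _ ∷ _ ∷ is) = x*0+y*0≤z*0 (δ n) Y (coefficient n false (4 ℕ.+ length is))

  sum-termBound-counted : Σ[ S ∈ cube (suc n) ] termBound (head S) (members (tail S)) ≡
                          X + Y * ℕtoℚ (suc n C 3) + δ n * (ε * sumFin n (b ∘ suc))
  sum-termBound-counted = begin
    Σ[ S ∈ cube (suc n) ] termBound (head S) (members (tail S))
      ≡⟨ sum-cube-suc n (λ s v → termBound s (members v)) (λ _ → refl) ⟩
    Σ[ v ∈ cube n ] termBound true (members v) + Σ[ v ∈ cube n ] termBound false (members v)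
      ≡⟨ cong₂ _+_ (sum-linear X Y (λ v → kronecker 0 (size v)) (λ v → kronecker 2 (size v)) (cube n))
                   (sum-linear (δ n) Y (λ v → singleton (λ a → ε * b (suc a)) (members v))
                                       (λ v → kronecker 3 (size v)) (cube n)) ⟩
    (X * Σ[ v ∈ cube n ] kronecker 0 (size v) + Y * Σ[ v ∈ cube n ] kronecker 2 (size v)) +
    (δ n * Σ[ v ∈ cube n ] singleton (λ a → ε * b (suc a)) (members v) + Y * Σ[ v ∈ cube n ] kronecker 3 (size v))
      ≡⟨ cong₂ _+_ (cong₂ (λ c₀ c₂ → X * c₀ + Y * c₂) (count-size n 0) (count-size n 2))
                   (cong₂ (λ s c₃ → δ n * s + Y * c₃) (trans (sum-singletons n _) (sum-*ˡ ε (b ∘ suc) (allFin n)))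
                                                      (count-size n 3)) ⟩
    (X * 1ℚ + Y * ℕtoℚ (n C 2)) + (δ n * (ε * sumFin n (b ∘ suc)) + Y * ℕtoℚ (n C 3))
      ≡⟨ regroup X Y (ℕtoℚ (n C 2)) (ℕtoℚ (n C 3)) (δ n * (ε * sumFin n (b ∘ suc))) ⟩
    X + Y * (ℕtoℚ (n C 2) + ℕtoℚ (n C 3)) + δ n * (ε * sumFin n (b ∘ suc))
      ≡⟨ cong (λ c → X + Y * c + δ n * (ε * sumFin n (b ∘ suc)))
              (trans (sym (ℕtoℚ-+ (n C 2) (n C 3))) (cong ℕtoℚ (nCk+nC[k+1]≡[n+1]C[k+1] n 2))) ⟩
    X + Y * ℕtoℚ (suc n C 3) + δ n * (ε * sumFin n (b ∘ suc)) ∎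
    where
    open ≡-Reasoning
    regroup : ∀ x y c₂ c₃ s → (x * 1ℚ + y * c₂) + (s + y * c₃) ≡ x + y * (c₂ + c₃) + s
    regroup = solve-∀ ℚ-ring

  sum-termBound : Σ[ S ∈ cube (suc n) ] termBound (head S) (members (tail S)) ≡
                  ε * (δ n * sumFin (suc n) (λ i → weight (suc n) i * b i))
  sum-termBound = begin
    Σ[ S ∈ cube (suc n) ] termBound (head S) (members (tail S))
      ≡⟨ sum-termBound-counted ⟩
    X + Y * K + δ n * (ε * Σb)
      ≡⟨ factor-C X (δ n) (constC (suc n)) ε b₀ K (δ n * (ε * Σb)) ⟩
    X - ε * b₀ * (constC (suc n) * (δ n * K)) + δ n * (ε * Σb)
      ≡⟨ cong (λ c → X - ε * b₀ * c + δ n * (ε * Σb))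
              (trans (constC-equation m) (cong (λ c → 1ℚ - c * δ n) (ℕtoℚ-suc (suc m)))) ⟩
    X - ε * b₀ * (1ℚ - (1ℚ + ℕtoℚ (suc m)) * δ n) + δ n * (ε * Σb)
      ≡⟨ collect (δ n) ε b₀ (ℕtoℚ (suc m)) Σb ⟩
    ε * (δ n * (ℕtoℚ (suc m) * b₀ + Σb))
      ≡⟨ cong (λ w → ε * (δ n * w)) weighted-bias-split ⟨
    ε * (δ n * sumFin (suc n) (λ i → weight (suc n) i * b i)) ∎
    where
    open ≡-Reasoning
    K Σb : ℚ
    K = ℕtoℚ (suc n C 3)
    Σb = sumFin n (b ∘ suc)
    factor-C : ∀ x d c ε b₀ K s → x + - (d * (c * ε * b₀)) * K + s ≡ x - ε * b₀ * (c * (d * K)) + s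
    factor-C = solve-∀ ℚ-ring
    collect : ∀ d ε b₀ c s → (1ℚ - d) * (ε * b₀) - ε * b₀ * (1ℚ - (1ℚ + c) * d) + d * (ε * s) ≡ ε * (d * (c * b₀ + s))
    collect = solve-∀ ℚ-ring
    weighted-bias-split : sumFin (suc n) (λ i → weight (suc n) i * b i) ≡ ℕtoℚ (suc m) * b₀ + Σb
    weighted-bias-split = trans (sumFin-suc n (λ i → weight (suc n) i * b i))
                                (cong (ℕtoℚ (suc m) * b₀ +_) (sum-cong (allFin n) (λ a → ℚ.*-identityˡ (b (suc a)))))

mainTheorem8 : (k : ℕ) → 3 ≤ k →
    (p : (Fin k → Bool) → ℚ) → IsDistributionOn k p →
    (∀ x → 0ℚ < p x → monarchy k (point x) ≡ 1ℚ) →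
    (ε : ℚ) → 0ℚ < ε →
    0ℚ < roundedAdvantage k p ε
mainTheorem8 (suc (suc (suc m))) (ℕ.s≤s (ℕ.s≤s (ℕ.s≤s _))) p D supported ε 0<ε = begin-strict
  0ℚ
    <⟨ *-pos 0<ε (*-pos (δ-pos n) (weighted-bias-pos D supported)) ⟩
  ε * (δ n * sumFin k (λ i → weight k i * b i))
    ≡⟨ sum-termBound m b ε ⟨
  Σ[ S ∈ cube k ] termBound m b ε (head S) (members (tail S))
    ≤⟨ sum-mono (cube k) term≥bound ⟩
  Σ[ S ∈ cube k ] (fourier k (monarchy k) S * roundedMoment k b ε S)
    ≡⟨ roundedAdvantage-cube k p ε ⟨
  roundedAdvantage k p ε ∎
  where
  open ℚ.≤-Reasoning
  n k : ℕ
  n = suc (suc m)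
  k = suc n
  b : Fin k → ℚ
  b = bias k p
  term≥bound : ∀ S → termBound m b ε (head S) (members (tail S)) ≤ℚ fourier k (monarchy k) S * roundedMoment k b ε S
  term≥bound S = ℚ.≤-trans
    (termBound≤term m b ε (bias-bound D supported) (*-nonNeg (constC-nonNeg m) (ℚ.<⇒≤ 0<ε)) (head S) (members (tail S)))
    (ℚ.≤-reflexive (sym (fourier-term m b ε S)))
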